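{- Let $n\ge 2$ and let $B_{2,\lfloor 3^n/2\rfloor}$ be the banana tree formed by joining one leaf of each of two disjoint copies of a star on $\lfloor 3^n/2\rfloor$ vertices to a new root vertex (so it has $3^n$ vertices). Then \[WL\Big(Q_n^3, B_{2,\lfloor 3^n/2\rfloor}\Big)=4n\Big( \Big\lceil\frac{3^n}{2}\Big\rceil-3\Big)+4\Big( \Big\lceil\frac{3^n}{2}\Big\rceil-2\Big)+4\Big( \Big\lceil\frac{3^n}{2}\Big\rceil-1\Big).\]
   Context: $Q_n^3$ is the graph on $\{0,1,2\}^n$ in which two tuples are adjacent iff they differ in exactly one coordinate $j$ and there $x_j\equiv y_j\pm1\pmod 3$. For a bijection $f:V(G)\to V(T)$ into a tree $T$, $WL_f(G,T)$ is the sum over edges $(u,v)$ of $G$ of the distance in $T$ between $f(u)$ and $f(v)$, and $WL(G,T)=\min_f WL_f(G,T)$. -}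

module Defs where

open import Data.Nat using (ℕ; zero; suc; _+_; _*_; _∸_; _^_; _≡ᵇ_; _<ᵇ_; ⌊_/2⌋; ⌈_/2⌉)
open import Data.Nat.DivMod using (_%_)
open import Data.Bool using (Bool; true; false; _∧_; _∨_; not; if_then_else_)
open import Data.Fin using (Fin; toℕ)
open import Data.Fin.Properties using (_≟_)
open import Data.Vec using (Vec; []; _∷_)
open import Data.List using (List; []; _∷_; [_]; map; concatMap; allFin; filter; _++_; length)
open import Data.Bool.ListAction using (any)
open import Data.Nat.ListAction using (sum)
open import Data.Product using (_×_; _,_; proj₁; proj₂)
open import Relation.Nullary.Decidable using (isYes)
open import Function.Bundles using (_⤖_; Bijection)

allVecs : (n : ℕ) → List (Vec (Fin 3) n)
allVecs zero = [ [] ]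
allVecs (suc n) = concatMap (λ x → map (x ∷_) (allVecs n)) (allFin 3)

hamming : {n : ℕ} → Vec (Fin 3) n → Vec (Fin 3) n → ℕ
hamming [] [] = 0
hamming (x ∷ xs) (y ∷ ys) = (if isYes (x ≟ y) then 0 else 1) + hamming xs ys

pm1 : Fin 3 → Fin 3 → Bool
pm1 x y = (toℕ x ≡ᵇ ((toℕ y + 1) % 3)) ∨ (toℕ x ≡ᵇ ((toℕ y + 2) % 3))

diffOK : {n : ℕ} → Vec (Fin 3) n → Vec (Fin 3) n → Bool
diffOK [] [] = true
diffOK (x ∷ xs) (y ∷ ys) = (isYes (x ≟ y) ∨ pm1 x y) ∧ diffOK xs ys

adjQ : {n : ℕ} → Vec (Fin 3) n → Vec (Fin 3) n → Bool
adjQ x y = (hamming x y ≡ᵇ 1) ∧ diffOK x y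

pairs : {A : Set} → List A → List (A × A)
pairs [] = []
pairs (x ∷ xs) = map (x ,_) xs ++ pairs xs

edgesQ : (n : ℕ) → List (Vec (Fin 3) n × Vec (Fin 3) n)
edgesQ n = filter (λ e → adjQ (proj₁ e) (proj₂ e) ≟b true) (pairs (allVecs n))
  where
  open import Data.Bool.Properties renaming (_≟_ to _≟b_)

reach : {N : ℕ} → (Fin N → Fin N → Bool) → ℕ → Fin N → Fin N → Bool
reach adj zero u v = isYes (u ≟ v)
reach {N} adj (suc d) u v =
  reach adj d u v ∨ any (λ w → reach adj d u w ∧ adj w v) (allFin N)

searchDist : {N : ℕ} → (Fin N → Fin N → Bool) → Fin N → Fin N → ℕ → ℕ → ℕ
searchDist adj u v cur zero = cur
searchDist adj u v cur (suc fuel) =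
  if reach adj cur u v then cur else searchDist adj u v (suc cur) fuel

-- shortest-path distance (for connected graphs on N vertices, dist ≤ N)
dist : {N : ℕ} → (Fin N → Fin N → Bool) → Fin N → Fin N → ℕ
dist {N} adj u v = searchDist adj u v 0 N

-- The banana tree B_{2,k} (on 2k+1 vertices), vertices labelled by ℕ:
--   0                      : the new root
--   for copy o ∈ {1, k+1}  : o = the leaf of the star joined to the root,
--                            o+1 = centre of the star,
--                            o+2, …, o+k-1 = the other k-2 leaves of the star
-- (a star on k vertices = centre + (k-1) leaves)

starEdge : ℕ → ℕ → ℕ → ℕ → Bool
starEdge k o a b =
  ((a ≡ᵇ o) ∧ (b ≡ᵇ suc o))
  ∨ ((a ≡ᵇ suc o) ∧ ((suc o <ᵇ b) ∧ (b <ᵇ o + k)))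

bananaEdge : ℕ → ℕ → ℕ → Bool
bananaEdge k a b =
  ((a ≡ᵇ 0) ∧ ((b ≡ᵇ 1) ∨ (b ≡ᵇ suc k)))
  ∨ starEdge k 1 a b ∨ starEdge k (suc k) a b

bananaAdjℕ : ℕ → ℕ → ℕ → Bool
bananaAdjℕ k a b = bananaEdge k a b ∨ bananaEdge k b a

-- B_{2,k} realised on Fin N (intended N = 2k+1)
bananaAdj : (N k : ℕ) → Fin N → Fin N → Bool
bananaAdj N k a b = bananaAdjℕ k (toℕ a) (toℕ b)

-- B_{2,⌊3^n/2⌋} on the vertex set Fin (3^n)  (3^n = 2⌊3^n/2⌋+1 since 3^n is odd)
bananaQ : (n : ℕ) → Fin (3 ^ n) → Fin (3 ^ n) → Bool
bananaQ n = bananaAdj (3 ^ n) ⌊ 3 ^ n /2⌋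

WLf : (n : ℕ) → (Vec (Fin 3) n ⤖ Fin (3 ^ n)) → ℕ
WLf n f = sum (map (λ e → dist (bananaQ n) (to (proj₁ e)) (to (proj₂ e))) (edgesQ n))
  where open Bijection f using (to)

WLvalue : ℕ → ℕ
WLvalue n = 4 * n * (c ∸ 3) + 4 * (c ∸ 2) + 4 * (c ∸ 1)
  where c = ⌈ 3 ^ n /2⌉

-- The wirelength of a bijection f from Q_n^3 = K₃ⁿ onto a tree is the sum, over the tree edges, of
-- the number of edges of K₃ⁿ cut by the inverse image of the subtree below that edge. A set of s
-- vertices of K₃ⁿ spans at most maxEdges s edges, the number spanned by the first s vertices in
-- lexicographic order (by induction on n, splitting by the first coordinate and merging the three
-- slices), so, K₃ⁿ being 2n-regular, it cuts at least 2ns − 2·maxEdges s edges; summing over the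
-- banana tree gives the lower bound. Laying out the vertices lexicographically along the two stars,
-- so that every subtree receives an initial or a final lexicographic segment, attains all these
-- bounds at once, and the sum evaluates to the stated formula.

module Submission where

open import Defs
open import Data.Nat hiding (_≟_)
open import Data.Nat.Properties hiding (_≟_)
open import Data.Nat.ListAction using (sum)
open import Data.Nat.ListAction.Properties using (sum-++)
open import Data.Nat.Tactic.RingSolver using (solve-∀)
open import Data.Bool using (Bool; true; false; _∧_; _∨_; _xor_; not; if_then_else_; T)
open import Data.Bool.ListAction using (any)
open import Data.Bool.Properties using (∧-comm; not-involutive; xor-same) renaming (_≟_ to _≟ᵇ_)
open import Data.Unit using (⊤; tt)
open import Data.Empty using (⊥; ⊥-elim)
open import Data.Fin using (Fin; toℕ; fromℕ<) renaming (suc to fsuc)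
open import Data.Fin.Patterns using (0F; 1F; 2F)
open import Data.Fin.Properties using (toℕ<n; toℕ-injective; toℕ-fromℕ<) renaming (_≟_ to _≟ᶠ_)
open import Data.Vec using (Vec; []; _∷_)
open import Data.List using (List; []; _∷_; map; filter; _++_; allFin)
open import Data.List.Properties using (map-++; map-∘; map-cong; map-tabulate; ++-identityʳ)
open import Data.List.Membership.Propositional using (_∈_)
open import Data.List.Membership.Propositional.Properties using (∈-allFin)
open import Data.List.Relation.Unary.Any using (here; there)
open import Data.Product using (Σ; _×_; _,_; proj₁; proj₂)
open import Data.Sum using (_⊎_; inj₁; inj₂)
open import Function using (_∘_; id)
open import Function.Bundles using (_⤖_; Bijection; mk⤖)
open import Relation.Binary using (tri<; tri≈; tri>)
open import Relation.Binary.PropositionalEquality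
open import Relation.Nullary using (yes; no; ¬_)
open import Relation.Nullary.Decidable using (isYes; toWitness; fromWitness)

⟦_⟧ : Bool → ℕ
⟦ true ⟧ = 1
⟦ false ⟧ = 0

⟦⟧≤1 : ∀ a → ⟦ a ⟧ ≤ 1
⟦⟧≤1 true = ≤-refl
⟦⟧≤1 false = z≤n

⟦∧⟧≤ˡ : ∀ a b → ⟦ a ∧ b ⟧ ≤ ⟦ a ⟧
⟦∧⟧≤ˡ true b = ⟦⟧≤1 b
⟦∧⟧≤ˡ false b = z≤n

⟦∧⟧≤ʳ : ∀ a b → ⟦ a ∧ b ⟧ ≤ ⟦ b ⟧
⟦∧⟧≤ʳ true b = ≤-refl
⟦∧⟧≤ʳ false b = z≤n

⟦⟧⊓⟦⟧ : ∀ a b → ⟦ a ⟧ ⊓ ⟦ b ⟧ ≡ ⟦ a ∧ b ⟧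
⟦⟧⊓⟦⟧ true true = refl
⟦⟧⊓⟦⟧ true false = refl
⟦⟧⊓⟦⟧ false b = refl

T⇒≡true : ∀ {b} → T b → b ≡ true
T⇒≡true {true} _ = refl

¬T⇒≡false : ∀ {b} → (T b → ⊥) → b ≡ false
¬T⇒≡false {true} ¬t = ⊥-elim (¬t tt)
¬T⇒≡false {false} _ = refl

T-extensional : ∀ {a b : Bool} → (T a → T b) → (T b → T a) → a ≡ b
T-extensional {true} {true} _ _ = refl
T-extensional {true} {false} f _ = ⊥-elim (f tt)
T-extensional {false} {true} _ g = ⊥-elim (g tt)
T-extensional {false} {false} _ _ = refl

T-∨-elim : ∀ {x y} → T (x ∨ y) → T x ⊎ T y
T-∨-elim {true} _ = inj₁ tt
T-∨-elim {false} t = inj₂ t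

T-∨ˡ : ∀ {x y} → T x → T (x ∨ y)
T-∨ˡ {true} _ = tt

T-∨ʳ : ∀ {x y} → T y → T (x ∨ y)
T-∨ʳ {true} _ = tt
T-∨ʳ {false} t = t

T-∧-elim : ∀ {x y} → T (x ∧ y) → T x × T y
T-∧-elim {true} {true} _ = tt , tt

T-∧-intro : ∀ {x y} → T x → T y → T (x ∧ y)
T-∧-intro {true} {true} _ _ = tt

≡ᵇ-refl : ∀ i → (i ≡ᵇ i) ≡ true
≡ᵇ-refl zero = refl
≡ᵇ-refl (suc i) = ≡ᵇ-refl i

≡ᵇ-sym : ∀ i j → (i ≡ᵇ j) ≡ (j ≡ᵇ i)
≡ᵇ-sym i j = T-extensional (λ t → ≡⇒≡ᵇ j i (sym (≡ᵇ⇒≡ i j t))) (λ t → ≡⇒≡ᵇ i j (sym (≡ᵇ⇒≡ j i t)))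

thrice : ℕ → ℕ
thrice q = q + q + q

div3 : ℕ → ℕ
div3 (suc (suc (suc m))) = suc (div3 m)
div3 _ = 0

mod3 : ℕ → ℕ
mod3 (suc (suc (suc m))) = mod3 m
mod3 m = m

thrice-suc : ∀ q → thrice (suc q) ≡ thrice q + 3
thrice-suc q = ring q
  where
  ring : ∀ q → suc q + suc q + suc q ≡ q + q + q + 3
  ring = solve-∀

thrice-mono-≤ : ∀ {x y} → x ≤ y → thrice x ≤ thrice y
thrice-mono-≤ p = +-mono-≤ (+-mono-≤ p p) p

thrice-mono-< : ∀ {x y} → x < y → thrice x + 3 ≤ thrice y
thrice-mono-< {x} p = ≤-trans (≤-reflexive (sym (thrice-suc x))) (thrice-mono-≤ p)

thrice-cancel-≤ : ∀ {x y} → thrice x ≤ thrice y → x ≤ y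
thrice-cancel-≤ {x} {y} p = ≮⇒≥ λ y<x →
  <-irrefl refl (≤-trans (m<m+n (thrice y) (s≤s z≤n)) (≤-trans (thrice-mono-< y<x) p))

thrice-suc+ : ∀ q r → thrice (suc q) + r ≡ suc (suc (suc (thrice q + r)))
thrice-suc+ q r = ring q r
  where
  ring : ∀ q r → suc q + suc q + suc q + r ≡ suc (suc (suc (q + q + q + r)))
  ring = solve-∀

div3≤ : ∀ m → div3 m ≤ m
div3≤ (suc (suc (suc m))) = s≤s (≤-trans (div3≤ m) (≤-trans (n≤1+n m) (n≤1+n (suc m))))
div3≤ (suc (suc zero)) = z≤n
div3≤ (suc zero) = z≤n
div3≤ zero = z≤n

1+div3< : ∀ m → 2 + div3 (2 + m) ≤ 2 + m
1+div3< zero = ≤-refl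
1+div3< (suc zero) = ≤-refl
1+div3< (suc (suc m)) = s≤s (s≤s (s≤s (div3≤ (suc m))))

div3-mod3-thrice+ : ∀ q r → r < 3 → div3 (thrice q + r) ≡ q × mod3 (thrice q + r) ≡ r
div3-mod3-thrice+ zero zero _ = refl , refl
div3-mod3-thrice+ zero (suc zero) _ = refl , refl
div3-mod3-thrice+ zero (suc (suc zero)) _ = refl , refl
div3-mod3-thrice+ zero (suc (suc (suc r))) (s≤s (s≤s (s≤s ())))
div3-mod3-thrice+ (suc q) r r<3 rewrite thrice-suc+ q r =
  cong suc (proj₁ (div3-mod3-thrice+ q r r<3)) , proj₂ (div3-mod3-thrice+ q r r<3)

thrice-div3+mod3 : ∀ m → m ≡ thrice (div3 m) + mod3 m
thrice-div3+mod3 zero = refl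
thrice-div3+mod3 (suc zero) = refl
thrice-div3+mod3 (suc (suc zero)) = refl
thrice-div3+mod3 (suc (suc (suc m))) =
  trans (cong (3 +_) (thrice-div3+mod3 m)) (sym (thrice-suc+ (div3 m) (mod3 m)))

mod3<3 : ∀ m → mod3 m < 3
mod3<3 zero = s≤s z≤n
mod3<3 (suc zero) = s≤s (s≤s z≤n)
mod3<3 (suc (suc zero)) = ≤-refl
mod3<3 (suc (suc (suc m))) = mod3<3 m

-- The edge-isoperimetric function of K₃ⁿ

-- m = 3q + r vertices split by their first coordinate into three blocks of sizes ⌈m/3⌉ ≥ · ≥ ⌊m/3⌋,
-- each recursively optimal; the edges between two blocks number the smaller block size.
threeBlocks : (ℕ → ℕ) → ℕ → ℕ → ℕ
threeBlocks g q zero = g q + g q + g q + thrice q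
threeBlocks g q (suc zero) = g (suc q) + g q + g q + thrice q
threeBlocks g q (suc (suc _)) = g (suc q) + g (suc q) + g q + suc (thrice q)

maxEdgesFuel : ℕ → ℕ → ℕ
maxEdgesFuel zero m = 0
maxEdgesFuel (suc fuel) m = threeBlocks (maxEdgesFuel fuel) (div3 m) (mod3 m)

-- maxEdges m is the largest number of edges of K₃ⁿ spanned by m vertices
-- (for any n with m ≤ 3ⁿ); it is attained by the first m vertices in
-- lexicographic order.
maxEdges : ℕ → ℕ
maxEdges m = maxEdgesFuel (suc m) m

maxEdgesFuel-0 : ∀ fuel → maxEdgesFuel fuel 0 ≡ 0
maxEdgesFuel-0 zero = refl
maxEdgesFuel-0 (suc fuel) rewrite maxEdgesFuel-0 fuel = refl

maxEdgesFuel-1 : ∀ fuel → maxEdgesFuel fuel 1 ≡ 0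
maxEdgesFuel-1 zero = refl
maxEdgesFuel-1 (suc fuel) rewrite maxEdgesFuel-0 fuel | maxEdgesFuel-1 fuel = refl

threeBlocks-cong : ∀ g g' q r → g q ≡ g' q → g (suc q) ≡ g' (suc q) →
                   threeBlocks g q r ≡ threeBlocks g' q r
threeBlocks-cong g g' q zero e _ rewrite e = refl
threeBlocks-cong g g' q (suc zero) e e' rewrite e | e' = refl
threeBlocks-cong g g' q (suc (suc r)) e e' rewrite e | e' = refl

maxEdgesFuel-irrelevant : ∀ f f' m → m < f → m < f' → maxEdgesFuel f m ≡ maxEdgesFuel f' m
maxEdgesFuel-irrelevant f f' zero _ _ = trans (maxEdgesFuel-0 f) (sym (maxEdgesFuel-0 f'))
maxEdgesFuel-irrelevant f f' (suc zero) _ _ = trans (maxEdgesFuel-1 f) (sym (maxEdgesFuel-1 f'))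
maxEdgesFuel-irrelevant (suc f) (suc f') (suc (suc m)) (s≤s p) (s≤s p') =
  threeBlocks-cong (maxEdgesFuel f) (maxEdgesFuel f') q (mod3 (2 + m))
    (maxEdgesFuel-irrelevant f f' q (<-weaken f p) (<-weaken f' p'))
    (maxEdgesFuel-irrelevant f f' (suc q) (≤-trans (1+div3< m) p) (≤-trans (1+div3< m) p'))
  where
  q = div3 (2 + m)
  <-weaken : ∀ g → 2 + m ≤ g → q < g
  <-weaken g le = ≤-trans (n≤1+n _) (≤-trans (1+div3< m) le)

maxEdgesFuel≡maxEdges : ∀ f x → x < f ⊎ x ≤ 1 → maxEdgesFuel f x ≡ maxEdges x
maxEdgesFuel≡maxEdges f x (inj₁ x<f) = maxEdgesFuel-irrelevant f (suc x) x x<f ≤-refl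
maxEdgesFuel≡maxEdges f zero (inj₂ _) = maxEdgesFuel-0 f
maxEdgesFuel≡maxEdges f (suc zero) (inj₂ _) = maxEdgesFuel-1 f
maxEdgesFuel≡maxEdges f (suc (suc x)) (inj₂ (s≤s ()))

≤1+q⇒<3q+r⊎≤1 : ∀ q r x → x ≤ suc q → x < thrice q + r ⊎ x ≤ 1
≤1+q⇒<3q+r⊎≤1 zero r x x≤ = inj₂ x≤
≤1+q⇒<3q+r⊎≤1 (suc p) r x x≤ =
  inj₁ (≤-trans (s≤s x≤) (≤-trans (m≤m+n (3 + p) (p + p)) (≤-trans (≤-reflexive (ring p)) (m≤m+n _ r))))
  where
  ring : ∀ p → 3 + p + (p + p) ≡ suc p + suc p + suc p
  ring = solve-∀

maxEdges-thrice+ : ∀ q r → r < 3 → maxEdges (thrice q + r) ≡ threeBlocks maxEdges q r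
maxEdges-thrice+ q r r<3 with div3-mod3-thrice+ q r r<3
... | e , e' = trans (cong₂ (threeBlocks (maxEdgesFuel (thrice q + r))) e e')
  (threeBlocks-cong _ maxEdges q r
    (maxEdgesFuel≡maxEdges _ q (≤1+q⇒<3q+r⊎≤1 q r q (n≤1+n q)))
    (maxEdgesFuel≡maxEdges _ (suc q) (≤1+q⇒<3q+r⊎≤1 q r (suc q) ≤-refl)))

pairMins : ℕ → ℕ → ℕ → ℕ
pairMins a b c = a ⊓ b + a ⊓ c + b ⊓ c

pairMins-shift : ∀ s x y z → pairMins (s + x) (s + y) (s + z) ≡ thrice s + pairMins x y z
pairMins-shift s x y z
  rewrite sym (+-distribˡ-⊓ s x y) | sym (+-distribˡ-⊓ s x z) | sym (+-distribˡ-⊓ s y z) =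
  ring s (x ⊓ y) (x ⊓ z) (y ⊓ z)
  where
  ring : ∀ s u v w → s + u + (s + v) + (s + w) ≡ s + s + s + (u + v + w)
  ring = solve-∀

maxEdges-bits : ∀ α a0 a1 a2 →
  maxEdges (thrice α + (⟦ a0 ⟧ + ⟦ a1 ⟧ + ⟦ a2 ⟧))
  ≡ maxEdges (α + ⟦ a0 ⟧) + maxEdges (α + ⟦ a1 ⟧) + maxEdges (α + ⟦ a2 ⟧)
    + (thrice α + pairMins ⟦ a0 ⟧ ⟦ a1 ⟧ ⟦ a2 ⟧)
maxEdges-bits α false false false rewrite +-identityʳ α =
  trans (maxEdges-thrice+ α 0 z<s) (ring (maxEdges α) (thrice α))
  where
  ring : ∀ A T → A + A + A + T ≡ A + A + A + (T + 0)
  ring = solve-∀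
maxEdges-bits α true false false rewrite +-identityʳ α | +-comm α 1 =
  trans (maxEdges-thrice+ α 1 (s<s z<s)) (ring (maxEdges α) (maxEdges (suc α)) (thrice α))
  where
  ring : ∀ A B T → B + A + A + T ≡ B + A + A + (T + 0)
  ring = solve-∀
maxEdges-bits α false true false rewrite +-identityʳ α | +-comm α 1 =
  trans (maxEdges-thrice+ α 1 (s<s z<s)) (ring (maxEdges α) (maxEdges (suc α)) (thrice α))
  where
  ring : ∀ A B T → B + A + A + T ≡ A + B + A + (T + 0)
  ring = solve-∀
maxEdges-bits α false false true rewrite +-identityʳ α | +-comm α 1 =
  trans (maxEdges-thrice+ α 1 (s<s z<s)) (ring (maxEdges α) (maxEdges (suc α)) (thrice α))
  where
  ring : ∀ A B T → B + A + A + T ≡ A + A + B + (T + 0)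
  ring = solve-∀
maxEdges-bits α true true false rewrite +-identityʳ α | +-comm α 1 =
  trans (maxEdges-thrice+ α 2 (s<s (s<s z<s))) (ring (maxEdges α) (maxEdges (suc α)) (thrice α))
  where
  ring : ∀ A B T → B + B + A + suc T ≡ B + B + A + (T + 1)
  ring = solve-∀
maxEdges-bits α true false true rewrite +-identityʳ α | +-comm α 1 =
  trans (maxEdges-thrice+ α 2 (s<s (s<s z<s))) (ring (maxEdges α) (maxEdges (suc α)) (thrice α))
  where
  ring : ∀ A B T → B + B + A + suc T ≡ B + A + B + (T + 1)
  ring = solve-∀
maxEdges-bits α false true true rewrite +-identityʳ α | +-comm α 1 =
  trans (maxEdges-thrice+ α 2 (s<s (s<s z<s))) (ring (maxEdges α) (maxEdges (suc α)) (thrice α))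
  where
  ring : ∀ A B T → B + B + A + suc T ≡ A + B + B + (T + 1)
  ring = solve-∀
maxEdges-bits α true true true rewrite +-comm α 1 =
  trans (cong maxEdges (ring₁ α)) (trans (maxEdges-thrice+ (suc α) 0 z<s) (ring₂ (maxEdges (suc α)) α))
  where
  ring₁ : ∀ α → α + α + α + 3 ≡ suc α + suc α + suc α + 0
  ring₁ = solve-∀
  ring₂ : ∀ B α → B + B + B + (suc α + suc α + suc α) ≡ B + B + B + (α + α + α + 3)
  ring₂ = solve-∀

-- Block sizes differing by at most one, for which the recursion of maxEdges takes a symmetric form.
data Balanced : ℕ → ℕ → ℕ → Set where
  balanced : ∀ s a0 a1 a2 → Balanced (s + ⟦ a0 ⟧) (s + ⟦ a1 ⟧) (s + ⟦ a2 ⟧)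

maxEdges-balanced : ∀ Q {e0 e1 e2} → Balanced e0 e1 e2 →
  maxEdges (thrice Q + (e0 + e1 + e2))
  ≡ maxEdges (Q + e0) + maxEdges (Q + e1) + maxEdges (Q + e2) + (thrice Q + pairMins e0 e1 e2)
maxEdges-balanced Q (balanced s a0 a1 a2) = begin
    maxEdges (thrice Q + (s + x + (s + y) + (s + z)))
  ≡⟨ cong maxEdges (ring₁ Q s x y z) ⟩
    maxEdges (thrice (Q + s) + (x + y + z))
  ≡⟨ maxEdges-bits (Q + s) a0 a1 a2 ⟩
    maxEdges (Q + s + x) + maxEdges (Q + s + y) + maxEdges (Q + s + z) + (thrice (Q + s) + pairMins x y z)
  ≡⟨ cong₂ _+_ (cong₂ _+_ (cong₂ _+_ (cong maxEdges (+-assoc Q s x)) (cong maxEdges (+-assoc Q s y)))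
                  (cong maxEdges (+-assoc Q s z)))
               (trans (ring₂ Q s (pairMins x y z)) (cong (thrice Q +_) (sym (pairMins-shift s x y z)))) ⟩
    maxEdges (Q + (s + x)) + maxEdges (Q + (s + y)) + maxEdges (Q + (s + z)) + (thrice Q + pairMins (s + x) (s + y) (s + z)) ∎
  where
  open ≡-Reasoning
  x = ⟦ a0 ⟧
  y = ⟦ a1 ⟧
  z = ⟦ a2 ⟧
  ring₁ : ∀ Q s x y z → Q + Q + Q + (s + x + (s + y) + (s + z)) ≡ Q + s + (Q + s) + (Q + s) + (x + y + z)
  ring₁ = solve-∀
  ring₂ : ∀ Q s m → Q + s + (Q + s) + (Q + s) + m ≡ Q + Q + Q + (s + s + s + m)
  ring₂ = solve-∀

bitSum : Bool → Bool → Bool → ℕ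
bitSum a0 a1 a2 = ⟦ a0 ⟧ + ⟦ a1 ⟧ + ⟦ a2 ⟧

commonBits : Bool → Bool → Bool → Bool → Bool → Bool → ℕ
commonBits a0 a1 a2 b0 b1 b2 = ⟦ a0 ∧ b0 ⟧ + ⟦ a1 ∧ b1 ⟧ + ⟦ a2 ∧ b2 ⟧

blockMins : ℕ → ℕ → Bool → Bool → Bool → Bool → Bool → Bool → ℕ
blockMins α β a0 a1 a2 b0 b1 b2 =
  (α + ⟦ a0 ⟧) ⊓ (β + ⟦ b0 ⟧) + (α + ⟦ a1 ⟧) ⊓ (β + ⟦ b1 ⟧) + (α + ⟦ a2 ⟧) ⊓ (β + ⟦ b2 ⟧)

BlockMinsBound : ℕ → ℕ → Bool → Bool → Bool → Bool → Bool → Bool → Set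
BlockMinsBound α β a0 a1 a2 b0 b1 b2 =
  (thrice α + bitSum a0 a1 a2) ⊓ (thrice β + bitSum b0 b1 b2) + commonBits a0 a1 a2 b0 b1 b2
  ≤ blockMins α β a0 a1 a2 b0 b1 b2 + bitSum a0 a1 a2 ⊓ bitSum b0 b1 b2

bitSum≤3 : ∀ a0 a1 a2 → bitSum a0 a1 a2 ≤ 3
bitSum≤3 a0 a1 a2 = +-mono-≤ (+-mono-≤ (⟦⟧≤1 a0) (⟦⟧≤1 a1)) (⟦⟧≤1 a2)

commonBits≤bitSum⊓bitSum : ∀ a0 a1 a2 b0 b1 b2 →
  commonBits a0 a1 a2 b0 b1 b2 ≤ bitSum a0 a1 a2 ⊓ bitSum b0 b1 b2
commonBits≤bitSum⊓bitSum a0 a1 a2 b0 b1 b2 = ⊓-glb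
  (+-mono-≤ (+-mono-≤ (⟦∧⟧≤ˡ a0 b0) (⟦∧⟧≤ˡ a1 b1)) (⟦∧⟧≤ˡ a2 b2))
  (+-mono-≤ (+-mono-≤ (⟦∧⟧≤ʳ a0 b0) (⟦∧⟧≤ʳ a1 b1)) (⟦∧⟧≤ʳ a2 b2))

spread-thrice : ∀ α x y z → α + x + (α + y) + (α + z) ≡ α + α + α + (x + y + z)
spread-thrice = solve-∀

blockMins-bound-< : ∀ α β a0 a1 a2 b0 b1 b2 → α < β → BlockMinsBound α β a0 a1 a2 b0 b1 b2
blockMins-bound-< α β a0 a1 a2 b0 b1 b2 α<β = begin
    (thrice α + SA) ⊓ (thrice β + SB) + D
  ≡⟨ cong (_+ D) (m≤n⇒m⊓n≡m (≤-trans (+-monoʳ-≤ (thrice α) (bitSum≤3 a0 a1 a2))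
                              (≤-trans (thrice-mono-< α<β) (m≤m+n _ _)))) ⟩
    thrice α + SA + D
  ≤⟨ +-monoʳ-≤ (thrice α + SA) (commonBits≤bitSum⊓bitSum a0 a1 a2 b0 b1 b2) ⟩
    thrice α + SA + SA ⊓ SB
  ≡⟨ cong (_+ SA ⊓ SB) (sym (trans (cong₂ _+_ (cong₂ _+_ (lower a0 b0) (lower a1 b1)) (lower a2 b2))
                                  (spread-thrice α ⟦ a0 ⟧ ⟦ a1 ⟧ ⟦ a2 ⟧))) ⟩
    blockMins α β a0 a1 a2 b0 b1 b2 + SA ⊓ SB ∎
  where
  open ≤-Reasoning
  SA = bitSum a0 a1 a2
  SB = bitSum b0 b1 b2
  D = commonBits a0 a1 a2 b0 b1 b2
  lower : ∀ a b → (α + ⟦ a ⟧) ⊓ (β + ⟦ b ⟧) ≡ α + ⟦ a ⟧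
  lower a b = m≤n⇒m⊓n≡m (≤-trans (+-monoʳ-≤ α (⟦⟧≤1 a))
                          (≤-trans (≤-reflexive (+-comm α 1)) (≤-trans α<β (m≤m+n β _))))

blockMins-bound-≡ : ∀ α a0 a1 a2 b0 b1 b2 → BlockMinsBound α α a0 a1 a2 b0 b1 b2
blockMins-bound-≡ α a0 a1 a2 b0 b1 b2 = ≤-reflexive (begin
    (thrice α + SA) ⊓ (thrice α + SB) + D
  ≡⟨ cong (_+ D) (sym (+-distribˡ-⊓ (thrice α) SA SB)) ⟩
    thrice α + SA ⊓ SB + D
  ≡⟨ +-assoc (thrice α) (SA ⊓ SB) D ⟩
    thrice α + (SA ⊓ SB + D)
  ≡⟨ cong (thrice α +_) (+-comm (SA ⊓ SB) D) ⟩
    thrice α + (D + SA ⊓ SB)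
  ≡⟨ sym (+-assoc (thrice α) D (SA ⊓ SB)) ⟩
    thrice α + D + SA ⊓ SB
  ≡⟨ cong (_+ SA ⊓ SB) (sym (trans (cong₂ _+_ (cong₂ _+_ (shared a0 b0) (shared a1 b1)) (shared a2 b2))
                                  (spread-thrice α ⟦ a0 ∧ b0 ⟧ ⟦ a1 ∧ b1 ⟧ ⟦ a2 ∧ b2 ⟧))) ⟩
    blockMins α α a0 a1 a2 b0 b1 b2 + SA ⊓ SB ∎)
  where
  open ≡-Reasoning
  SA = bitSum a0 a1 a2
  SB = bitSum b0 b1 b2
  D = commonBits a0 a1 a2 b0 b1 b2
  shared : ∀ a b → (α + ⟦ a ⟧) ⊓ (α + ⟦ b ⟧) ≡ α + ⟦ a ∧ b ⟧
  shared a b = trans (sym (+-distribˡ-⊓ α ⟦ a ⟧ ⟦ b ⟧)) (cong (α +_) (⟦⟧⊓⟦⟧ a b))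

blockMins-bound : ∀ α β a0 a1 a2 b0 b1 b2 → BlockMinsBound α β a0 a1 a2 b0 b1 b2
blockMins-bound α β a0 a1 a2 b0 b1 b2 with <-cmp α β
... | tri< α<β _ _ = blockMins-bound-< α β a0 a1 a2 b0 b1 b2 α<β
... | tri≈ _ refl _ = blockMins-bound-≡ α a0 a1 a2 b0 b1 b2
... | tri> _ _ β<α = subst₂ _≤_ swapˡ swapʳ (blockMins-bound-< β α b0 b1 b2 a0 a1 a2 β<α)
  where
  swapˡ : (thrice β + bitSum b0 b1 b2) ⊓ (thrice α + bitSum a0 a1 a2) + commonBits b0 b1 b2 a0 a1 a2
        ≡ (thrice α + bitSum a0 a1 a2) ⊓ (thrice β + bitSum b0 b1 b2) + commonBits a0 a1 a2 b0 b1 b2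
  swapˡ = cong₂ _+_ (⊓-comm (thrice β + bitSum b0 b1 b2) _)
    (cong₂ _+_ (cong₂ _+_ (cong ⟦_⟧ (∧-comm b0 a0)) (cong ⟦_⟧ (∧-comm b1 a1))) (cong ⟦_⟧ (∧-comm b2 a2)))
  swapʳ : blockMins β α b0 b1 b2 a0 a1 a2 + bitSum b0 b1 b2 ⊓ bitSum a0 a1 a2
        ≡ blockMins α β a0 a1 a2 b0 b1 b2 + bitSum a0 a1 a2 ⊓ bitSum b0 b1 b2
  swapʳ = cong₂ _+_ (cong₂ _+_ (cong₂ _+_ (⊓-comm (β + ⟦ b0 ⟧) _) (⊓-comm (β + ⟦ b1 ⟧) _)) (⊓-comm (β + ⟦ b2 ⟧) _))
                    (⊓-comm (bitSum b0 b1 b2) _)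

-- Ensures that the merged column Q + E is smaller than the whole, so that induction applies.
columnFits : ℕ → ℕ → Bool
columnFits E X = (E <ᵇ X) ∨ ((E ≤ᵇ X) ∧ (X ≤ᵇ 1))

columnFits-sound : ∀ E X → T (columnFits E X) → E < X ⊎ (E ≤ X × X ≤ 1)
columnFits-sound E X t with E <ᵇ X in eq
... | true = inj₁ (<ᵇ⇒< E X (subst T (sym eq) tt))
... | false with E ≤ᵇ X in eq₂ | X ≤ᵇ 1 in eq₃
...   | true | true = inj₂ (≤ᵇ⇒≤ E X (subst T (sym eq₂) tt) , ≤ᵇ⇒≤ X 1 (subst T (sym eq₃) tt))

column<total : ∀ Q X E f → T (columnFits E X) → 2 ≤ thrice Q + X → thrice Q + X ≤ suc f → Q + E ≤ f
column<total zero X E f t 2≤X X≤ with columnFits-sound E X t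
... | inj₁ E<X = ≤-pred (≤-trans E<X X≤)
... | inj₂ (_ , X≤1) with ≤-trans 2≤X X≤1
...   | s≤s ()
column<total (suc Q) X E f t _ X≤ = ≤-trans (+-monoʳ-≤ (suc Q) E≤X) (≤-pred (≤-trans Q+X< X≤))
  where
  E≤X : E ≤ X
  E≤X with columnFits-sound E X t
  ... | inj₁ E<X = <⇒≤ E<X
  ... | inj₂ (E≤X , _) = E≤X
  Q+X< : suc (suc Q + X) ≤ thrice (suc Q) + X
  Q+X< = +-monoˡ-≤ X (≤-trans (s≤s (m≤n+m (suc Q) Q)) (m≤m+n _ (suc Q)))

MergeBound : ℕ → ℕ → ℕ → Set
MergeBound a b c = maxEdges a + maxEdges b + maxEdges c + pairMins a b c ≤ maxEdges (a + b + c)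

MergeBoundBelow : ℕ → Set
MergeBoundBelow f = ∀ x y z → x + y + z ≤ f → MergeBound x y z

-- The sets of sizes a = 3α + Σ aᵢ, b, c are split into blocks α + aᵢ, β + bᵢ, γ + cᵢ;
-- merging the i-th blocks recursively and then the three results balanced
-- gives the bound, provided the bits satisfy the four checks below.
module MergeStep (f α β γ : ℕ) (a0 a1 a2 b0 b1 b2 c0 c1 c2 : Bool) where

  SA = bitSum a0 a1 a2
  SB = bitSum b0 b1 b2
  SC = bitSum c0 c1 c2
  X = SA + SB + SC
  a = thrice α + SA
  b = thrice β + SB
  c = thrice γ + SC
  Q = α + β + γ
  E0 = ⟦ a0 ⟧ + ⟦ b0 ⟧ + ⟦ c0 ⟧
  E1 = ⟦ a1 ⟧ + ⟦ b1 ⟧ + ⟦ c1 ⟧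
  E2 = ⟦ a2 ⟧ + ⟦ b2 ⟧ + ⟦ c2 ⟧
  Dab = commonBits a0 a1 a2 b0 b1 b2
  Dac = commonBits a0 a1 a2 c0 c1 c2
  Dbc = commonBits b0 b1 b2 c0 c1 c2
  D = Dab + Dac + Dbc
  mA = pairMins ⟦ a0 ⟧ ⟦ a1 ⟧ ⟦ a2 ⟧
  mB = pairMins ⟦ b0 ⟧ ⟦ b1 ⟧ ⟦ b2 ⟧
  mC = pairMins ⟦ c0 ⟧ ⟦ c1 ⟧ ⟦ c2 ⟧
  mE = pairMins E0 E1 E2

  total≡ : a + b + c ≡ thrice Q + X
  total≡ = ring α β γ SA SB SC
    where
    ring : ∀ α β γ x y z → α + α + α + x + (β + β + β + y) + (γ + γ + γ + z)
                           ≡ α + β + γ + (α + β + γ) + (α + β + γ) + (x + y + z)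
    ring = solve-∀

  X≡columns : X ≡ E0 + E1 + E2
  X≡columns = ring ⟦ a0 ⟧ ⟦ a1 ⟧ ⟦ a2 ⟧ ⟦ b0 ⟧ ⟦ b1 ⟧ ⟦ b2 ⟧ ⟦ c0 ⟧ ⟦ c1 ⟧ ⟦ c2 ⟧
    where
    ring : ∀ a0 a1 a2 b0 b1 b2 c0 c1 c2 → a0 + a1 + a2 + (b0 + b1 + b2) + (c0 + c1 + c2)
                                         ≡ (a0 + b0 + c0) + (a1 + b1 + c1) + (a2 + b2 + c2)
    ring = solve-∀

  column≡ : ∀ x y z → α + x + (β + y) + (γ + z) ≡ Q + (x + y + z)
  column≡ = ring α β γ
    where
    ring : ∀ α β γ x y z → α + x + (β + y) + (γ + z) ≡ α + β + γ + (x + y + z)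
    ring = solve-∀

  thrice-sum : thrice α + thrice β + thrice γ ≡ thrice Q
  thrice-sum = ring α β γ
    where
    ring : ∀ α β γ → α + α + α + (β + β + β) + (γ + γ + γ) ≡ α + β + γ + (α + β + γ) + (α + β + γ)
    ring = solve-∀

  merge-column : MergeBoundBelow f → 2 ≤ a + b + c → a + b + c ≤ suc f →
                 ∀ x y z → T (columnFits (⟦ x ⟧ + ⟦ y ⟧ + ⟦ z ⟧) X) →
                 maxEdges (α + ⟦ x ⟧) + maxEdges (β + ⟦ y ⟧) + maxEdges (γ + ⟦ z ⟧)
                   + pairMins (α + ⟦ x ⟧) (β + ⟦ y ⟧) (γ + ⟦ z ⟧)
                 ≤ maxEdges (Q + (⟦ x ⟧ + ⟦ y ⟧ + ⟦ z ⟧))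
  merge-column ih 2≤ ≤f x y z fits =
    subst (λ w → maxEdges (α + ⟦ x ⟧) + maxEdges (β + ⟦ y ⟧) + maxEdges (γ + ⟦ z ⟧)
                   + pairMins (α + ⟦ x ⟧) (β + ⟦ y ⟧) (γ + ⟦ z ⟧) ≤ maxEdges w)
      (column≡ ⟦ x ⟧ ⟦ y ⟧ ⟦ z ⟧)
      (ih (α + ⟦ x ⟧) (β + ⟦ y ⟧) (γ + ⟦ z ⟧) (≤-trans (≤-reflexive (column≡ ⟦ x ⟧ ⟦ y ⟧ ⟦ z ⟧))
        (column<total Q X _ f fits (subst (2 ≤_) total≡ 2≤) (subst (_≤ suc f) total≡ ≤f))))

  merge-step : MergeBoundBelow f → Balanced E0 E1 E2 →
               T (mA + mB + mC + pairMins SA SB SC ≤ᵇ mE + D) →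
               T (columnFits E0 X) → T (columnFits E1 X) → T (columnFits E2 X) →
               2 ≤ a + b + c → a + b + c ≤ suc f → MergeBound a b c
  merge-step ih bal bits fits0 fits1 fits2 2≤ ≤f = +-cancelʳ-≤ D _ _ (begin
      maxEdges a + maxEdges b + maxEdges c + pairMins a b c + D
    ≡⟨ cong (λ u → u + pairMins a b c + D)
         (cong₂ _+_ (cong₂ _+_ (maxEdges-bits α a0 a1 a2) (maxEdges-bits β b0 b1 b2)) (maxEdges-bits γ c0 c1 c2)) ⟩
      (h x0 + h x1 + h x2 + (thrice α + mA)) + (h y0 + h y1 + h y2 + (thrice β + mB))
        + (h z0 + h z1 + h z2 + (thrice γ + mC)) + pairMins a b c + D
    ≡⟨ regroup₁ (h x0) (h x1) (h x2) (h y0) (h y1) (h y2) (h z0) (h z1) (h z2) (thrice α) (thrice β) (thrice γ)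
                mA mB mC (a ⊓ b) (a ⊓ c) (b ⊓ c) Dab Dac Dbc ⟩
      H0 + H1 + H2 + T3 + (mA + mB + mC) + ((a ⊓ b + Dab) + (a ⊓ c + Dac) + (b ⊓ c + Dbc))
    ≤⟨ +-monoʳ-≤ (H0 + H1 + H2 + T3 + (mA + mB + mC))
         (+-mono-≤ (+-mono-≤ (blockMins-bound α β a0 a1 a2 b0 b1 b2) (blockMins-bound α γ a0 a1 a2 c0 c1 c2))
                   (blockMins-bound β γ b0 b1 b2 c0 c1 c2)) ⟩
      H0 + H1 + H2 + T3 + (mA + mB + mC) + ((Pab + SA ⊓ SB) + (Pac + SA ⊓ SC) + (Pbc + SB ⊓ SC))
    ≡⟨ regroup₂ (H0 + H1 + H2) T3 (mA + mB + mC) Pab Pac Pbc (SA ⊓ SB) (SA ⊓ SC) (SB ⊓ SC) ⟩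
      H0 + H1 + H2 + (Pab + Pac + Pbc) + T3 + (mA + mB + mC + pairMins SA SB SC)
    ≤⟨ +-monoʳ-≤ (H0 + H1 + H2 + (Pab + Pac + Pbc) + T3) (≤ᵇ⇒≤ _ _ bits) ⟩
      H0 + H1 + H2 + (Pab + Pac + Pbc) + T3 + (mE + D)
    ≡⟨ cong (λ u → H0 + H1 + H2 + u + T3 + (mE + D))
         (transpose (x0 ⊓ y0) (x1 ⊓ y1) (x2 ⊓ y2) (x0 ⊓ z0) (x1 ⊓ z1) (x2 ⊓ z2) (y0 ⊓ z0) (y1 ⊓ z1) (y2 ⊓ z2)) ⟩
      H0 + H1 + H2 + (M0 + M1 + M2) + T3 + (mE + D)
    ≡⟨ regroup₃ H0 H1 H2 M0 M1 M2 T3 mE D ⟩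
      (H0 + M0) + (H1 + M1) + (H2 + M2) + (T3 + mE) + D
    ≤⟨ +-monoˡ-≤ D (+-mono-≤ (+-mono-≤ (+-mono-≤ (column a0 b0 c0 fits0) (column a1 b1 c1 fits1))
                                       (column a2 b2 c2 fits2))
                             (≤-reflexive (cong (_+ mE) thrice-sum))) ⟩
      h (Q + E0) + h (Q + E1) + h (Q + E2) + (thrice Q + mE) + D
    ≡⟨ cong (_+ D) (sym (maxEdges-balanced Q bal)) ⟩
      h (thrice Q + (E0 + E1 + E2)) + D
    ≡⟨ cong (λ u → h u + D) (sym (trans total≡ (cong (thrice Q +_) X≡columns))) ⟩
      h (a + b + c) + D ∎)
    where
    open ≤-Reasoning
    h = maxEdges
    column = merge-column ih 2≤ ≤f
    T3 = thrice α + thrice β + thrice γ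
    x0 = α + ⟦ a0 ⟧
    x1 = α + ⟦ a1 ⟧
    x2 = α + ⟦ a2 ⟧
    y0 = β + ⟦ b0 ⟧
    y1 = β + ⟦ b1 ⟧
    y2 = β + ⟦ b2 ⟧
    z0 = γ + ⟦ c0 ⟧
    z1 = γ + ⟦ c1 ⟧
    z2 = γ + ⟦ c2 ⟧
    H0 = h x0 + h y0 + h z0
    H1 = h x1 + h y1 + h z1
    H2 = h x2 + h y2 + h z2
    M0 = pairMins x0 y0 z0
    M1 = pairMins x1 y1 z1
    M2 = pairMins x2 y2 z2
    Pab = blockMins α β a0 a1 a2 b0 b1 b2
    Pac = blockMins α γ a0 a1 a2 c0 c1 c2
    Pbc = blockMins β γ b0 b1 b2 c0 c1 c2
    transpose : ∀ p0 p1 p2 q0 q1 q2 r0 r1 r2 → (p0 + p1 + p2) + (q0 + q1 + q2) + (r0 + r1 + r2)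
                                             ≡ (p0 + q0 + r0) + (p1 + q1 + r1) + (p2 + q2 + r2)
    transpose = solve-∀
    regroup₁ : ∀ hx0 hx1 hx2 hy0 hy1 hy2 hz0 hz1 hz2 Ta Tb Tc mA mB mC ab ac bc dab dac dbc →
      (hx0 + hx1 + hx2 + (Ta + mA)) + (hy0 + hy1 + hy2 + (Tb + mB)) + (hz0 + hz1 + hz2 + (Tc + mC))
        + (ab + ac + bc) + (dab + dac + dbc)
      ≡ (hx0 + hy0 + hz0) + (hx1 + hy1 + hz1) + (hx2 + hy2 + hz2) + (Ta + Tb + Tc) + (mA + mB + mC)
        + ((ab + dab) + (ac + dac) + (bc + dbc))
    regroup₁ hx0 hx1 hx2 hy0 hy1 hy2 hz0 hz1 hz2 Ta Tb Tc mA mB mC ab ac bc dab dac dbc =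
      trans (outer (hx0 + hx1 + hx2) (hy0 + hy1 + hy2) (hz0 + hz1 + hz2) Ta Tb Tc mA mB mC
                   (ab + ac + bc) (dab + dac + dbc))
            (cong₂ (λ u v → u + (Ta + Tb + Tc) + (mA + mB + mC) + v)
                   (transpose hx0 hx1 hx2 hy0 hy1 hy2 hz0 hz1 hz2) (interleave ab ac bc dab dac dbc))
      where
      outer : ∀ A B C Ta Tb Tc mA mB mC M D →
        (A + (Ta + mA)) + (B + (Tb + mB)) + (C + (Tc + mC)) + M + D
        ≡ (A + B + C) + (Ta + Tb + Tc) + (mA + mB + mC) + (M + D)
      outer = solve-∀
      interleave : ∀ ab ac bc dab dac dbc →
        (ab + ac + bc) + (dab + dac + dbc) ≡ (ab + dab) + (ac + dac) + (bc + dbc)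
      interleave = solve-∀
    regroup₂ : ∀ H T m Pab Pac Pbc sab sac sbc →
      H + T + m + ((Pab + sab) + (Pac + sac) + (Pbc + sbc)) ≡ H + (Pab + Pac + Pbc) + T + (m + (sab + sac + sbc))
    regroup₂ = solve-∀
    regroup₃ : ∀ H0 H1 H2 M0 M1 M2 T m D →
      H0 + H1 + H2 + (M0 + M1 + M2) + T + (m + D) ≡ (H0 + M0) + (H1 + M1) + (H2 + M2) + (T + m) + D
    regroup₃ = solve-∀

open MergeStep using (merge-step)

-- The bits spreading the digits x, y, z over the three blocks, chosen so that all four checks of merge-step hold.
merge-digits : ∀ f α β γ x y z → x < 3 → y < 3 → z < 3 → MergeBoundBelow f →
  2 ≤ (thrice α + x) + (thrice β + y) + (thrice γ + z) →
  (thrice α + x) + (thrice β + y) + (thrice γ + z) ≤ suc f →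
  MergeBound (thrice α + x) (thrice β + y) (thrice γ + z)
merge-digits f α β γ 0 0 0 _ _ _ ih = merge-step f α β γ false false false false false false false false false ih (balanced 0 false false false) tt tt tt tt
merge-digits f α β γ 0 0 1 _ _ _ ih = merge-step f α β γ false false false false false false true false false ih (balanced 0 true false false) tt tt tt tt
merge-digits f α β γ 0 0 2 _ _ _ ih = merge-step f α β γ false false false false false false true true false ih (balanced 0 true true false) tt tt tt tt
merge-digits f α β γ 0 1 0 _ _ _ ih = merge-step f α β γ false false false true false false false false false ih (balanced 0 true false false) tt tt tt tt
merge-digits f α β γ 0 1 1 _ _ _ ih = merge-step f α β γ false false false true false false false true false ih (balanced 0 true true false) tt tt tt tt
merge-digits f α β γ 0 1 2 _ _ _ ih = merge-step f α β γ false false false true false false false true true ih (balanced 1 false false false) tt tt tt tt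
merge-digits f α β γ 0 2 0 _ _ _ ih = merge-step f α β γ false false false true true false false false false ih (balanced 0 true true false) tt tt tt tt
merge-digits f α β γ 0 2 1 _ _ _ ih = merge-step f α β γ false false false true true false false false true ih (balanced 1 false false false) tt tt tt tt
merge-digits f α β γ 0 2 2 _ _ _ ih = merge-step f α β γ false false false true true false true false true ih (balanced 1 true false false) tt tt tt tt
merge-digits f α β γ 1 0 0 _ _ _ ih = merge-step f α β γ true false false false false false false false false ih (balanced 0 true false false) tt tt tt tt
merge-digits f α β γ 1 0 1 _ _ _ ih = merge-step f α β γ true false false false false false false true false ih (balanced 0 true true false) tt tt tt tt
merge-digits f α β γ 1 0 2 _ _ _ ih = merge-step f α β γ true false false false false false false true true ih (balanced 1 false false false) tt tt tt tt
merge-digits f α β γ 1 1 0 _ _ _ ih = merge-step f α β γ true false false false true false false false false ih (balanced 0 true true false) tt tt tt tt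
merge-digits f α β γ 1 1 1 _ _ _ ih = merge-step f α β γ true false false false true false false false true ih (balanced 1 false false false) tt tt tt tt
merge-digits f α β γ 1 1 2 _ _ _ ih = merge-step f α β γ true false false false true false true false true ih (balanced 1 true false false) tt tt tt tt
merge-digits f α β γ 1 2 0 _ _ _ ih = merge-step f α β γ true false false false true true false false false ih (balanced 1 false false false) tt tt tt tt
merge-digits f α β γ 1 2 1 _ _ _ ih = merge-step f α β γ true false false false true true true false false ih (balanced 1 true false false) tt tt tt tt
merge-digits f α β γ 1 2 2 _ _ _ ih = merge-step f α β γ true false false false true true true true false ih (balanced 1 true true false) tt tt tt tt
merge-digits f α β γ 2 0 0 _ _ _ ih = merge-step f α β γ true true false false false false false false false ih (balanced 0 true true false) tt tt tt tt
merge-digits f α β γ 2 0 1 _ _ _ ih = merge-step f α β γ true true false false false false false false true ih (balanced 1 false false false) tt tt tt tt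
merge-digits f α β γ 2 0 2 _ _ _ ih = merge-step f α β γ true true false false false false true false true ih (balanced 1 true false false) tt tt tt tt
merge-digits f α β γ 2 1 0 _ _ _ ih = merge-step f α β γ true true false false false true false false false ih (balanced 1 false false false) tt tt tt tt
merge-digits f α β γ 2 1 1 _ _ _ ih = merge-step f α β γ true true false false false true true false false ih (balanced 1 true false false) tt tt tt tt
merge-digits f α β γ 2 1 2 _ _ _ ih = merge-step f α β γ true true false false false true true true false ih (balanced 1 true true false) tt tt tt tt
merge-digits f α β γ 2 2 0 _ _ _ ih = merge-step f α β γ true true false true false true false false false ih (balanced 1 true false false) tt tt tt tt
merge-digits f α β γ 2 2 1 _ _ _ ih = merge-step f α β γ true true false true false true false true false ih (balanced 1 true true false) tt tt tt tt
merge-digits f α β γ 2 2 2 _ _ _ ih = merge-step f α β γ true true false true false true false true true ih (balanced 1 true true true) tt tt tt tt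
merge-digits f α β γ (suc (suc (suc x))) y z (s≤s (s≤s (s≤s ()))) _ _ ih
merge-digits f α β γ x (suc (suc (suc y))) z _ (s≤s (s≤s (s≤s ()))) _ ih
merge-digits f α β γ x y (suc (suc (suc z))) _ _ (s≤s (s≤s (s≤s ()))) ih

merge-small : ∀ a b c → a + b + c ≤ 1 → MergeBound a b c
merge-small zero zero zero _ = z≤n
merge-small (suc zero) zero zero _ = z≤n
merge-small zero (suc zero) zero _ = z≤n
merge-small zero zero (suc zero) _ = z≤n
merge-small (suc (suc a)) b c (s≤s ())
merge-small (suc zero) (suc b) c (s≤s ())
merge-small (suc zero) zero (suc c) (s≤s ())
merge-small zero (suc (suc b)) c (s≤s ())
merge-small zero (suc zero) (suc c) (s≤s ())
merge-small zero zero (suc (suc c)) (s≤s ())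

merge-below : ∀ f → MergeBoundBelow f
merge-below zero a b c a+b+c≤0 = merge-small a b c (≤-trans a+b+c≤0 z≤n)
merge-below (suc f) a b c a+b+c≤ with a + b + c ≤? 1
... | yes small = merge-small a b c small
... | no big = subst₃ MergeBound (sym (split a)) (sym (split b)) (sym (split c))
  (merge-digits f (div3 a) (div3 b) (div3 c) (mod3 a) (mod3 b) (mod3 c) (mod3<3 a) (mod3<3 b) (mod3<3 c)
    (merge-below f) (subst (2 ≤_) digits (≰⇒> big)) (subst (_≤ suc f) digits a+b+c≤))
  where
  split = thrice-div3+mod3
  digits : a + b + c ≡ (thrice (div3 a) + mod3 a) + (thrice (div3 b) + mod3 b) + (thrice (div3 c) + mod3 c)
  digits = cong₂ _+_ (cong₂ _+_ (split a) (split b)) (split c)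
  subst₃ : ∀ (P : ℕ → ℕ → ℕ → Set) {x x′ y y′ z z′} →
           x ≡ x′ → y ≡ y′ → z ≡ z′ → P x y z → P x′ y′ z′
  subst₃ P refl refl refl p = p

maxEdges-merge : ∀ a b c → maxEdges a + maxEdges b + maxEdges c + pairMins a b c ≤ maxEdges (a + b + c)
maxEdges-merge a b c = merge-below (a + b + c) a b c ≤-refl

Vertex : ℕ → Set
Vertex = Vec (Fin 3)

Pair : ℕ → Set
Pair n = Vertex n × Vertex n

sumMap : {A : Set} → (A → ℕ) → List A → ℕ
sumMap f xs = sum (map f xs)

sumMap-++ : {A : Set} (f : A → ℕ) (xs ys : List A) → sumMap f (xs ++ ys) ≡ sumMap f xs + sumMap f ys
sumMap-++ f xs ys = trans (cong sum (map-++ f xs ys)) (sum-++ (map f xs) (map f ys))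

sumMap-map : {A B : Set} (f : B → ℕ) (g : A → B) (xs : List A) → sumMap f (map g xs) ≡ sumMap (f ∘ g) xs
sumMap-map f g xs = cong sum (sym (map-∘ xs))

sumMap-cong : {A : Set} {f g : A → ℕ} → (∀ x → f x ≡ g x) → (xs : List A) → sumMap f xs ≡ sumMap g xs
sumMap-cong e xs = cong sum (map-cong e xs)

sumMap-mono : {A : Set} {f g : A → ℕ} → (∀ x → f x ≤ g x) → (xs : List A) → sumMap f xs ≤ sumMap g xs
sumMap-mono e [] = z≤n
sumMap-mono e (x ∷ xs) = +-mono-≤ (e x) (sumMap-mono e xs)

sumMap-+ : {A : Set} (f g : A → ℕ) (xs : List A) → sumMap (λ x → f x + g x) xs ≡ sumMap f xs + sumMap g xs
sumMap-+ f g [] = refl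
sumMap-+ f g (x ∷ xs) rewrite sumMap-+ f g xs = ring (f x) (g x) (sumMap f xs) (sumMap g xs)
  where
  ring : ∀ a b c d → a + b + (c + d) ≡ a + c + (b + d)
  ring = solve-∀

sumMap-0 : {A : Set} (xs : List A) → sumMap (λ _ → 0) xs ≡ 0
sumMap-0 [] = refl
sumMap-0 (x ∷ xs) = sumMap-0 xs

sumMap-* : {A : Set} (c : ℕ) (f : A → ℕ) (xs : List A) → sumMap (λ x → c * f x) xs ≡ c * sumMap f xs
sumMap-* c f [] = sym (*-zeroʳ c)
sumMap-* c f (x ∷ xs) rewrite sumMap-* c f xs = sym (*-distribˡ-+ c (f x) (sumMap f xs))

sumMap-swap : {A B : Set} (F : A → B → ℕ) (xs : List A) (ys : List B) →
              sumMap (λ x → sumMap (F x) ys) xs ≡ sumMap (λ y → sumMap (λ x → F x y) xs) ys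
sumMap-swap F [] ys = sym (sumMap-0 ys)
sumMap-swap F (x ∷ xs) ys rewrite sumMap-swap F xs ys = sym (sumMap-+ (F x) (λ y → sumMap (λ x → F x y) xs) ys)

vertexSum : (n : ℕ) → (Vertex n → ℕ) → ℕ
vertexSum n φ = sumMap φ (allVecs n)

vertexSum-+ : ∀ n f g → vertexSum n (λ x → f x + g x) ≡ vertexSum n f + vertexSum n g
vertexSum-+ n f g = sumMap-+ f g (allVecs n)

vertexSum-+₃ : ∀ n f g h → vertexSum n (λ x → f x + g x + h x) ≡ vertexSum n f + vertexSum n g + vertexSum n h
vertexSum-+₃ n f g h = trans (vertexSum-+ n _ h) (cong (_+ vertexSum n h) (vertexSum-+ n f g))

vertexSum-cong : ∀ n {f g} → (∀ x → f x ≡ g x) → vertexSum n f ≡ vertexSum n g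
vertexSum-cong n e = sumMap-cong e (allVecs n)

vertexSum-mono : ∀ n {f g} → (∀ x → f x ≤ g x) → vertexSum n f ≤ vertexSum n g
vertexSum-mono n e = sumMap-mono e (allVecs n)

prefixed : ∀ n → Fin 3 → List (Vertex (suc n))
prefixed n i = map (i ∷_) (allVecs n)

vertexSum-suc : ∀ n φ → vertexSum (suc n) φ
                ≡ vertexSum n (λ x → φ (0F ∷ x)) + vertexSum n (λ x → φ (1F ∷ x)) + vertexSum n (λ x → φ (2F ∷ x))
vertexSum-suc n φ = begin
    sumMap φ (prefixed n 0F ++ (prefixed n 1F ++ (prefixed n 2F ++ [])))
  ≡⟨ sumMap-++ φ (prefixed n 0F) _ ⟩
    sumMap φ (prefixed n 0F) + sumMap φ (prefixed n 1F ++ (prefixed n 2F ++ []))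
  ≡⟨ cong (sumMap φ (prefixed n 0F) +_) (sumMap-++ φ (prefixed n 1F) _) ⟩
    sumMap φ (prefixed n 0F) + (sumMap φ (prefixed n 1F) + sumMap φ (prefixed n 2F ++ []))
  ≡⟨ cong (λ u → sumMap φ (prefixed n 0F) + (sumMap φ (prefixed n 1F) + u))
          (trans (sumMap-++ φ (prefixed n 2F) []) (+-identityʳ _)) ⟩
    sumMap φ (prefixed n 0F) + (sumMap φ (prefixed n 1F) + sumMap φ (prefixed n 2F))
  ≡⟨ sym (+-assoc (sumMap φ (prefixed n 0F)) _ _) ⟩
    sumMap φ (prefixed n 0F) + sumMap φ (prefixed n 1F) + sumMap φ (prefixed n 2F)
  ≡⟨ cong₂ _+_ (cong₂ _+_ (sumMap-map φ _ (allVecs n)) (sumMap-map φ _ (allVecs n))) (sumMap-map φ _ (allVecs n)) ⟩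
    vertexSum n (λ x → φ (0F ∷ x)) + vertexSum n (λ x → φ (1F ∷ x)) + vertexSum n (λ x → φ (2F ∷ x)) ∎
  where open ≡-Reasoning

sameVec : ∀ {n} → Vertex n → Vertex n → Bool
sameVec [] [] = true
sameVec (x ∷ xs) (y ∷ ys) = isYes (x ≟ᶠ y) ∧ sameVec xs ys

sameVec-refl : ∀ {n} (x : Vertex n) → sameVec x x ≡ true
sameVec-refl [] = refl
sameVec-refl (0F ∷ x) = sameVec-refl x
sameVec-refl (1F ∷ x) = sameVec-refl x
sameVec-refl (2F ∷ x) = sameVec-refl x

sameVec-sound : ∀ {n} (x y : Vertex n) → sameVec x y ≡ true → x ≡ y
sameVec-sound [] [] _ = refl
sameVec-sound (a ∷ x) (b ∷ y) e with a ≟ᶠ b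
sameVec-sound (a ∷ x) (.a ∷ y) e | yes refl = cong (a ∷_) (sameVec-sound x y e)
sameVec-sound (a ∷ x) (b ∷ y) () | no _

vertexSum-δ : ∀ n (x : Vertex n) (φ : Vertex n → ℕ) →
              vertexSum n (λ y → if sameVec x y then φ y else 0) ≡ φ x
vertexSum-δ zero [] φ = +-identityʳ (φ [])
vertexSum-δ (suc n) (a ∷ x) φ = trans (vertexSum-suc n _) (byHead a)
  where
  column : Fin 3 → Fin 3 → ℕ
  column b i = vertexSum n (λ y → if sameVec (b ∷ x) (i ∷ y) then φ (i ∷ y) else 0)
  vanish : vertexSum n (λ _ → 0) ≡ 0
  vanish = sumMap-0 (allVecs n)
  byHead : ∀ b → column b 0F + column b 1F + column b 2F ≡ φ (b ∷ x)
  byHead 0F rewrite vertexSum-δ n x (λ y → φ (0F ∷ y)) | vanish = trans (+-identityʳ _) (+-identityʳ _)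
  byHead 1F rewrite vertexSum-δ n x (λ y → φ (1F ∷ y)) | vanish = +-identityʳ _
  byHead 2F rewrite vertexSum-δ n x (λ y → φ (2F ∷ y)) | vanish = refl

crossSum : {A : Set} → (A × A → ℕ) → List A → List A → ℕ
crossSum G xs ys = sumMap (λ a → sumMap (λ b → G (a , b)) ys) xs

crossSum-++ : {A : Set} (G : A × A → ℕ) (xs ys zs : List A) →
              crossSum G xs (ys ++ zs) ≡ crossSum G xs ys + crossSum G xs zs
crossSum-++ G xs ys zs = trans (sumMap-cong (λ a → sumMap-++ (λ b → G (a , b)) ys zs) xs) (sumMap-+ _ _ xs)

pairSum-++ : {A : Set} (G : A × A → ℕ) (xs ys : List A) →
  sumMap G (pairs (xs ++ ys)) ≡ sumMap G (pairs xs) + sumMap G (pairs ys) + crossSum G xs ys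
pairSum-++ G [] ys = sym (+-identityʳ _)
pairSum-++ G (a ∷ xs) ys = begin
    sumMap G (map (a ,_) (xs ++ ys) ++ pairs (xs ++ ys))
  ≡⟨ sumMap-++ G (map (a ,_) (xs ++ ys)) (pairs (xs ++ ys)) ⟩
    sumMap G (map (a ,_) (xs ++ ys)) + sumMap G (pairs (xs ++ ys))
  ≡⟨ cong₂ _+_ (trans (sumMap-map G (a ,_) (xs ++ ys)) (sumMap-++ Gₐ xs ys)) (pairSum-++ G xs ys) ⟩
    (sumMap Gₐ xs + sumMap Gₐ ys) + (sumMap G (pairs xs) + sumMap G (pairs ys) + crossSum G xs ys)
  ≡⟨ ring (sumMap Gₐ xs) (sumMap Gₐ ys) (sumMap G (pairs xs)) (sumMap G (pairs ys)) (crossSum G xs ys) ⟩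
    (sumMap Gₐ xs + sumMap G (pairs xs)) + sumMap G (pairs ys) + crossSum G (a ∷ xs) ys
  ≡⟨ cong (λ u → u + sumMap G (pairs ys) + crossSum G (a ∷ xs) ys)
          (sym (trans (sumMap-++ G (map (a ,_) xs) (pairs xs)) (cong (_+ sumMap G (pairs xs)) (sumMap-map G (a ,_) xs)))) ⟩
    sumMap G (map (a ,_) xs ++ pairs xs) + sumMap G (pairs ys) + crossSum G (a ∷ xs) ys ∎
  where
  open ≡-Reasoning
  Gₐ = λ b → G (a , b)
  ring : ∀ p q r s t → (p + q) + (r + s + t) ≡ (p + r) + s + (q + t)
  ring = solve-∀

pairSum-map : {A B : Set} (G : B × B → ℕ) (f : A → B) (xs : List A) →
  sumMap G (pairs (map f xs)) ≡ sumMap (λ e → G (f (proj₁ e) , f (proj₂ e))) (pairs xs)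
pairSum-map G f [] = refl
pairSum-map G f (x ∷ xs) =
  begin
    sumMap G (map (f x ,_) (map f xs) ++ pairs (map f xs))
  ≡⟨ sumMap-++ G (map (f x ,_) (map f xs)) (pairs (map f xs)) ⟩
    sumMap G (map (f x ,_) (map f xs)) + sumMap G (pairs (map f xs))
  ≡⟨ cong₂ _+_ (trans (sumMap-map G (f x ,_) (map f xs)) (trans (sumMap-map _ f xs) (sym (sumMap-map _ (x ,_) xs))))
               (pairSum-map G f xs) ⟩
    sumMap G' (map (x ,_) xs) + sumMap G' (pairs xs)
  ≡⟨ sym (sumMap-++ G' (map (x ,_) xs) (pairs xs)) ⟩
    sumMap G' (map (x ,_) xs ++ pairs xs) ∎
  where
  open ≡-Reasoning
  G' = λ (e : _ × _) → G (f (proj₁ e) , f (proj₂ e))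

edgeSum : (n : ℕ) → (Pair n → ℕ) → ℕ
edgeSum n g = sumMap g (edgesQ n)

edgeSum-+ : ∀ n f g → edgeSum n (λ e → f e + g e) ≡ edgeSum n f + edgeSum n g
edgeSum-+ n f g = sumMap-+ f g (edgesQ n)

edgeSum-cong : ∀ n {f g} → (∀ e → f e ≡ g e) → edgeSum n f ≡ edgeSum n g
edgeSum-cong n e = sumMap-cong e (edgesQ n)

onEdge : ∀ {n} → (Pair n → ℕ) → Pair n → ℕ
onEdge g e = if adjQ (proj₁ e) (proj₂ e) then g e else 0

sumMap-filterEdges : ∀ {n} (g : Pair n → ℕ) xs →
  sumMap g (filter (λ e → adjQ (proj₁ e) (proj₂ e) ≟ᵇ true) xs) ≡ sumMap (onEdge g) xs
sumMap-filterEdges g [] = refl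
sumMap-filterEdges g (e ∷ xs) with adjQ (proj₁ e) (proj₂ e)
... | true = cong (g e +_) (sumMap-filterEdges g xs)
... | false = sumMap-filterEdges g xs

edgeSum≡pairSum : ∀ n g → edgeSum n g ≡ sumMap (onEdge g) (pairs (allVecs n))
edgeSum≡pairSum n g = sumMap-filterEdges g (pairs (allVecs n))

noDifference≡sameVec : ∀ {n} (x y : Vertex n) → (hamming x y ≡ᵇ 0) ∧ diffOK x y ≡ sameVec x y
noDifference≡sameVec [] [] = refl
noDifference≡sameVec (a ∷ x) (b ∷ y) with a ≟ᶠ b
... | yes refl = noDifference≡sameVec x y
... | no _ = refl

edgeSum-between : ∀ n (g : Pair (suc n) → ℕ) (i j : Fin 3) →
  (∀ (x y : Vertex n) → adjQ (i ∷ x) (j ∷ y) ≡ sameVec x y) →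
  crossSum (onEdge g) (prefixed n i) (prefixed n j) ≡ vertexSum n (λ x → g (i ∷ x , j ∷ x))
edgeSum-between n g i j adj≡ = begin
    crossSum (onEdge g) (prefixed n i) (prefixed n j)
  ≡⟨ sumMap-map _ (i ∷_) (allVecs n) ⟩
    sumMap (λ x → sumMap (λ b → onEdge g (i ∷ x , b)) (prefixed n j)) (allVecs n)
  ≡⟨ sumMap-cong (λ x → sumMap-map _ (j ∷_) (allVecs n)) (allVecs n) ⟩
    sumMap (λ x → sumMap (λ y → onEdge g (i ∷ x , j ∷ y)) (allVecs n)) (allVecs n)
  ≡⟨ sumMap-cong (λ x → trans (sumMap-cong (λ y → cong (λ b → if b then g (i ∷ x , j ∷ y) else 0) (adj≡ x y)) (allVecs n))
                               (vertexSum-δ n x (λ y → g (i ∷ x , j ∷ y)))) (allVecs n) ⟩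
    vertexSum n (λ x → g (i ∷ x , j ∷ x)) ∎
  where open ≡-Reasoning

edgeSum-within : ∀ n (g : Pair (suc n) → ℕ) (i : Fin 3) →
  (∀ (x y : Vertex n) → adjQ (i ∷ x) (i ∷ y) ≡ adjQ x y) →
  sumMap (onEdge g) (pairs (prefixed n i)) ≡ edgeSum n (λ e → g (i ∷ proj₁ e , i ∷ proj₂ e))
edgeSum-within n g i adj≡ = trans (pairSum-map (onEdge g) (i ∷_) (allVecs n))
  (trans (sumMap-cong (λ e → cong (λ b → if b then g (i ∷ proj₁ e , i ∷ proj₂ e) else 0) (adj≡ (proj₁ e) (proj₂ e)))
                      (pairs (allVecs n)))
         (sym (edgeSum≡pairSum n _)))

edgeSum-suc : ∀ n g → edgeSum (suc n) g ≡
  edgeSum n (λ e → g (0F ∷ proj₁ e , 0F ∷ proj₂ e)) + edgeSum n (λ e → g (1F ∷ proj₁ e , 1F ∷ proj₂ e))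
    + edgeSum n (λ e → g (2F ∷ proj₁ e , 2F ∷ proj₂ e))
    + vertexSum n (λ x → g (0F ∷ x , 1F ∷ x) + g (0F ∷ x , 2F ∷ x) + g (1F ∷ x , 2F ∷ x))
edgeSum-suc n g = begin
    edgeSum (suc n) g
  ≡⟨ edgeSum≡pairSum (suc n) g ⟩
    P (L 0F ++ (L 1F ++ (L 2F ++ [])))
  ≡⟨ cong (λ l → P (L 0F ++ (L 1F ++ l))) (++-identityʳ (L 2F)) ⟩
    P (L 0F ++ (L 1F ++ L 2F))
  ≡⟨ pairSum-++ G (L 0F) (L 1F ++ L 2F) ⟩
    P (L 0F) + P (L 1F ++ L 2F) + C (L 0F) (L 1F ++ L 2F)
  ≡⟨ cong₂ (λ u v → P (L 0F) + u + v) (pairSum-++ G (L 1F) (L 2F)) (crossSum-++ G (L 0F) (L 1F) (L 2F)) ⟩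
    P (L 0F) + (P (L 1F) + P (L 2F) + C (L 1F) (L 2F)) + (C (L 0F) (L 1F) + C (L 0F) (L 2F))
  ≡⟨ cong₂ _+_ (cong₂ _+_ (within 0F (λ _ _ → refl))
                          (cong₂ _+_ (cong₂ _+_ (within 1F (λ _ _ → refl)) (within 2F (λ _ _ → refl)))
                                     (between 1F 2F noDifference≡sameVec)))
               (cong₂ _+_ (between 0F 1F noDifference≡sameVec) (between 0F 2F noDifference≡sameVec)) ⟩
    E 0F + (E 1F + E 2F + V 1F 2F) + (V 0F 1F + V 0F 2F)
  ≡⟨ ring (E 0F) (E 1F) (E 2F) (V 0F 1F) (V 0F 2F) (V 1F 2F) ⟩
    E 0F + E 1F + E 2F + (V 0F 1F + V 0F 2F + V 1F 2F)
  ≡⟨ cong (E 0F + E 1F + E 2F +_) (sym (vertexSum-+₃ n _ _ _)) ⟩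
    E 0F + E 1F + E 2F + vertexSum n (λ x → g (0F ∷ x , 1F ∷ x) + g (0F ∷ x , 2F ∷ x) + g (1F ∷ x , 2F ∷ x)) ∎
  where
  open ≡-Reasoning
  G = onEdge g
  L = prefixed n
  P = λ xs → sumMap G (pairs xs)
  C = crossSum G
  E : Fin 3 → ℕ
  E i = edgeSum n (λ e → g (i ∷ proj₁ e , i ∷ proj₂ e))
  V : Fin 3 → Fin 3 → ℕ
  V i j = vertexSum n (λ x → g (i ∷ x , j ∷ x))
  within : ∀ i → (∀ (x y : Vertex n) → adjQ (i ∷ x) (i ∷ y) ≡ adjQ x y) → P (L i) ≡ E i
  within i = edgeSum-within n g i
  between : ∀ i j → (∀ (x y : Vertex n) → adjQ (i ∷ x) (j ∷ y) ≡ sameVec x y) → C (L i) (L j) ≡ V i j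
  between i j = edgeSum-between n g i j
  ring : ∀ a b c d e f → a + (b + c + f) + (d + e) ≡ a + b + c + (d + e + f)
  ring = solve-∀

size : ∀ n → (Vertex n → Bool) → ℕ
size n P = vertexSum n (λ v → ⟦ P v ⟧)

cut : ∀ n → (Vertex n → Bool) → ℕ
cut n P = edgeSum n (λ e → ⟦ P (proj₁ e) xor P (proj₂ e) ⟧)

inner : ∀ n → (Vertex n → Bool) → ℕ
inner n P = edgeSum n (λ e → ⟦ P (proj₁ e) ∧ P (proj₂ e) ⟧)

handshake : ∀ n (φ : Vertex n → ℕ) → edgeSum n (λ e → φ (proj₁ e) + φ (proj₂ e)) ≡ (n + n) * vertexSum n φ
handshake zero φ = refl
handshake (suc n) φ = begin
    edgeSum (suc n) (λ e → φ (proj₁ e) + φ (proj₂ e))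
  ≡⟨ edgeSum-suc n _ ⟩
    ends φ₀ + ends φ₁ + ends φ₂ + vertexSum n (λ x → (φ₀ x + φ₁ x) + (φ₀ x + φ₂ x) + (φ₁ x + φ₂ x))
  ≡⟨ cong₂ _+_ (cong₂ _+_ (cong₂ _+_ (handshake n φ₀) (handshake n φ₁)) (handshake n φ₂)) across ⟩
    (n + n) * A + (n + n) * B + (n + n) * C + (2 * A + 2 * B + 2 * C)
  ≡⟨ ring n A B C ⟩
    (suc n + suc n) * (A + B + C)
  ≡⟨ cong ((suc n + suc n) *_) (sym (vertexSum-suc n φ)) ⟩
    (suc n + suc n) * vertexSum (suc n) φ ∎
  where
  open ≡-Reasoning
  φ₀ φ₁ φ₂ : Vertex n → ℕ
  φ₀ x = φ (0F ∷ x)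
  φ₁ x = φ (1F ∷ x)
  φ₂ x = φ (2F ∷ x)
  A = vertexSum n φ₀
  B = vertexSum n φ₁
  C = vertexSum n φ₂
  ends : (Vertex n → ℕ) → ℕ
  ends ψ = edgeSum n (λ e → ψ (proj₁ e) + ψ (proj₂ e))
  regroup : ∀ a b c → (a + b) + (a + c) + (b + c) ≡ 2 * a + 2 * b + 2 * c
  regroup = solve-∀
  across : vertexSum n (λ x → (φ₀ x + φ₁ x) + (φ₀ x + φ₂ x) + (φ₁ x + φ₂ x)) ≡ 2 * A + 2 * B + 2 * C
  across = trans (vertexSum-cong n (λ x → regroup (φ₀ x) (φ₁ x) (φ₂ x)))
    (trans (vertexSum-+₃ n _ _ _)
      (cong₂ _+_ (cong₂ _+_ (sumMap-* 2 φ₀ (allVecs n)) (sumMap-* 2 φ₁ (allVecs n))) (sumMap-* 2 φ₂ (allVecs n))))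
  ring : ∀ n A B C → (n + n) * A + (n + n) * B + (n + n) * C + (2 * A + 2 * B + 2 * C)
                   ≡ (suc n + suc n) * (A + B + C)
  ring = solve-∀

⟦xor⟧+2*⟦∧⟧ : ∀ a b → ⟦ a xor b ⟧ + 2 * ⟦ a ∧ b ⟧ ≡ ⟦ a ⟧ + ⟦ b ⟧
⟦xor⟧+2*⟦∧⟧ true true = refl
⟦xor⟧+2*⟦∧⟧ true false = refl
⟦xor⟧+2*⟦∧⟧ false true = refl
⟦xor⟧+2*⟦∧⟧ false false = refl

cut+2*inner : ∀ n P → cut n P + 2 * inner n P ≡ (n + n) * size n P
cut+2*inner n P =
  begin
    cut n P + 2 * inner n P
  ≡⟨ cong (cut n P +_) (sym (sumMap-* 2 _ (edgesQ n))) ⟩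
    cut n P + edgeSum n (λ e → 2 * ⟦ P (proj₁ e) ∧ P (proj₂ e) ⟧)
  ≡⟨ sym (edgeSum-+ n _ _) ⟩
    edgeSum n (λ e → ⟦ P (proj₁ e) xor P (proj₂ e) ⟧ + 2 * ⟦ P (proj₁ e) ∧ P (proj₂ e) ⟧)
  ≡⟨ edgeSum-cong n (λ e → ⟦xor⟧+2*⟦∧⟧ (P (proj₁ e)) (P (proj₂ e))) ⟩
    edgeSum n (λ e → ⟦ P (proj₁ e) ⟧ + ⟦ P (proj₂ e) ⟧)
  ≡⟨ handshake n (λ v → ⟦ P v ⟧) ⟩
    (n + n) * size n P ∎
  where open ≡-Reasoning

vertexSum-∧≤⊓ : ∀ n (A B : Vertex n → Bool) → vertexSum n (λ x → ⟦ A x ∧ B x ⟧) ≤ size n A ⊓ size n B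
vertexSum-∧≤⊓ n A B =
  ⊓-glb (vertexSum-mono n (λ x → ⟦∧⟧≤ˡ (A x) (B x))) (vertexSum-mono n (λ x → ⟦∧⟧≤ʳ (A x) (B x)))

inner≤maxEdges : ∀ n P → inner n P ≤ maxEdges (size n P)
inner≤maxEdges zero P = z≤n
inner≤maxEdges (suc n) P = begin
    inner (suc n) P
  ≡⟨ edgeSum-suc n _ ⟩
    inner n P₀ + inner n P₁ + inner n P₂ + vertexSum n (λ x → ⟦ P₀ x ∧ P₁ x ⟧ + ⟦ P₀ x ∧ P₂ x ⟧ + ⟦ P₁ x ∧ P₂ x ⟧)
  ≡⟨ cong (inner n P₀ + inner n P₁ + inner n P₂ +_) (vertexSum-+₃ n _ _ _) ⟩
    inner n P₀ + inner n P₁ + inner n P₂ + (common P₀ P₁ + common P₀ P₂ + common P₁ P₂)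
  ≤⟨ +-mono-≤ (+-mono-≤ (+-mono-≤ (inner≤maxEdges n P₀) (inner≤maxEdges n P₁)) (inner≤maxEdges n P₂))
              (+-mono-≤ (+-mono-≤ (vertexSum-∧≤⊓ n P₀ P₁) (vertexSum-∧≤⊓ n P₀ P₂)) (vertexSum-∧≤⊓ n P₁ P₂)) ⟩
    maxEdges (size n P₀) + maxEdges (size n P₁) + maxEdges (size n P₂) + pairMins (size n P₀) (size n P₁) (size n P₂)
  ≤⟨ maxEdges-merge (size n P₀) (size n P₁) (size n P₂) ⟩
    maxEdges (size n P₀ + size n P₁ + size n P₂)
  ≡⟨ cong maxEdges (sym (vertexSum-suc n (λ v → ⟦ P v ⟧))) ⟩
    maxEdges (size (suc n) P) ∎
  where
  open ≤-Reasoning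
  P₀ P₁ P₂ : Vertex n → Bool
  P₀ x = P (0F ∷ x)
  P₁ x = P (1F ∷ x)
  P₂ x = P (2F ∷ x)
  common : (Vertex n → Bool) → (Vertex n → Bool) → ℕ
  common A B = vertexSum n (λ x → ⟦ A x ∧ B x ⟧)

-- The lexicographic order

3^suc≡thrice : ∀ n → 3 ^ suc n ≡ thrice (3 ^ n)
3^suc≡thrice n = ring (3 ^ n)
  where
  ring : ∀ x → 3 * x ≡ x + x + x
  ring = solve-∀

x+t<x+3 : ∀ x {t} → t < 3 → suc (x + t) ≤ x + 3
x+t<x+3 x {t} t<3 = ≤-trans (≤-reflexive (sym (+-suc x t))) (+-monoʳ-≤ x t<3)

rank : ∀ {n} → Vertex n → ℕ
rank [] = 0
rank (t ∷ w) = thrice (rank w) + toℕ t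

rank< : ∀ {n} (v : Vertex n) → rank v < 3 ^ n
rank< [] = s≤s z≤n
rank< {suc n} (t ∷ w) = ≤-trans (x+t<x+3 (thrice (rank w)) (toℕ<n t))
  (≤-trans (thrice-mono-< (rank< w)) (≤-reflexive (sym (3^suc≡thrice n))))

rank-injective : ∀ {n} (v w : Vertex n) → rank v ≡ rank w → v ≡ w
rank-injective [] [] _ = refl
rank-injective (a ∷ v) (b ∷ w) e = cong₂ _∷_ (toℕ-injective mod3≡) (rank-injective v w div3≡)
  where
  digitsᵃ = div3-mod3-thrice+ (rank v) (toℕ a) (toℕ<n a)
  digitsᵇ = div3-mod3-thrice+ (rank w) (toℕ b) (toℕ<n b)
  div3≡ : rank v ≡ rank w
  div3≡ = trans (sym (proj₁ digitsᵃ)) (trans (cong div3 e) (proj₁ digitsᵇ))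
  mod3≡ : toℕ a ≡ toℕ b
  mod3≡ = trans (sym (proj₂ digitsᵃ)) (trans (cong mod3 e) (proj₂ digitsᵇ))

unrank : ∀ n → ℕ → Vertex n
unrank zero m = []
unrank (suc n) m = fromℕ< (mod3<3 m) ∷ unrank n (div3 m)

rank-unrank : ∀ n m → m < 3 ^ n → rank (unrank n m) ≡ m
rank-unrank zero zero _ = refl
rank-unrank zero (suc m) (s≤s ())
rank-unrank (suc n) m m< =
  trans (cong₂ _+_ (cong thrice (rank-unrank n (div3 m) div3<)) (toℕ-fromℕ< _)) (sym (thrice-div3+mod3 m))
  where
  div3< : div3 m < 3 ^ n
  div3< = ≰⇒> λ 3^n≤ → <-irrefl refl (≤-trans m< (≤-trans (≤-reflexive (3^suc≡thrice n))
            (≤-trans (thrice-mono-≤ 3^n≤) (≤-trans (m≤m+n _ _) (≤-reflexive (sym (thrice-div3+mod3 m)))))))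

lexBelow : ∀ {n} → ℕ → Vertex n → Bool
lexBelow m v = rank v <ᵇ m

-- Below 3q + ρ, the vertices with first digit i and tail w are those with w below this.
sliceBound : ℕ → ℕ → Fin 3 → ℕ
sliceBound q ρ i = q + ⟦ toℕ i <ᵇ ρ ⟧

thrice+<ᵇthrice+ : ∀ r t q ρ → t < 3 → ρ < 3 → (thrice r + t <ᵇ thrice q + ρ) ≡ (r <ᵇ q + ⟦ t <ᵇ ρ ⟧)
thrice+<ᵇthrice+ r t q ρ t<3 ρ<3 = T-extensional (λ x → <⇒<ᵇ (to (<ᵇ⇒< _ _ x))) (λ x → <⇒<ᵇ (from (<ᵇ⇒< _ _ x)))
  where
  to : thrice r + t < thrice q + ρ → r < q + ⟦ t <ᵇ ρ ⟧
  to lt with <-cmp r q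
  ... | tri< r<q _ _ = ≤-trans r<q (m≤m+n q _)
  ... | tri≈ _ refl _ rewrite T⇒≡true (<⇒<ᵇ (+-cancelˡ-< (thrice r) t ρ lt)) = ≤-reflexive (+-comm 1 r)
  ... | tri> _ _ q<r = ⊥-elim (<-irrefl refl (≤-trans lt (≤-trans (+-monoʳ-≤ (thrice q) (<⇒≤ ρ<3))
                         (≤-trans (thrice-mono-< q<r) (m≤m+n _ t)))))
  from : r < q + ⟦ t <ᵇ ρ ⟧ → thrice r + t < thrice q + ρ
  from lt with <-cmp r q | t <ᵇ ρ in t<ᵇρ
  ... | tri< r<q _ _ | _ = ≤-trans (x+t<x+3 (thrice r) t<3) (≤-trans (thrice-mono-< r<q) (m≤m+n _ ρ))
  ... | tri≈ _ refl _ | true = +-monoʳ-< (thrice r) (<ᵇ⇒< t ρ (subst T (sym t<ᵇρ) tt))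
  ... | tri≈ _ refl _ | false = ⊥-elim (<-irrefl (sym (+-identityʳ r)) lt)
  ... | tri> _ _ q<r | b = ⊥-elim (<-irrefl refl (≤-trans lt (≤-trans (+-monoʳ-≤ q (⟦⟧≤1 b))
                             (≤-trans (≤-reflexive (+-comm q 1)) q<r))))

lexBelow-∷ : ∀ {n} q ρ (i : Fin 3) (w : Vertex n) → ρ < 3 →
             lexBelow (thrice q + ρ) (i ∷ w) ≡ lexBelow (sliceBound q ρ i) w
lexBelow-∷ q ρ i w ρ<3 = thrice+<ᵇthrice+ (rank w) (toℕ i) q ρ (toℕ<n i) ρ<3

sliceBound≤ : ∀ q ρ M i → thrice q + ρ ≤ thrice M → sliceBound q ρ i ≤ M
sliceBound≤ q ρ M i le with toℕ i <ᵇ ρ in i<ᵇρ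
... | false = ≤-trans (≤-reflexive (+-identityʳ q)) (thrice-cancel-≤ (≤-trans (m≤m+n (thrice q) ρ) le))
... | true = ≤-trans (≤-reflexive (+-comm q 1)) (≰⇒> λ M≤q →
  <-irrefl refl (≤-trans (≤-trans (≤-reflexive (+-comm 1 (thrice M))) (+-monoʳ-≤ (thrice M) 1≤ρ))
                         (≤-trans (+-monoˡ-≤ ρ (thrice-mono-≤ M≤q)) le)))
  where
  1≤ρ : 1 ≤ ρ
  1≤ρ = ≤-trans (s≤s z≤n) (<ᵇ⇒< (toℕ i) ρ (subst T (sym i<ᵇρ) tt))

sliceBounds-sum : ∀ q ρ → ρ < 3 → sliceBound q ρ 0F + sliceBound q ρ 1F + sliceBound q ρ 2F ≡ thrice q + ρ
sliceBounds-sum q zero _ = ring q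
  where
  ring : ∀ q → q + 0 + (q + 0) + (q + 0) ≡ q + q + q + 0
  ring = solve-∀
sliceBounds-sum q (suc zero) _ = ring q
  where
  ring : ∀ q → q + 1 + (q + 0) + (q + 0) ≡ q + q + q + 1
  ring = solve-∀
sliceBounds-sum q (suc (suc zero)) _ = ring q
  where
  ring : ∀ q → q + 1 + (q + 1) + (q + 0) ≡ q + q + q + 2
  ring = solve-∀
sliceBounds-sum q (suc (suc (suc ρ))) (s≤s (s≤s (s≤s ())))

maxEdges-sliceBounds : ∀ q ρ → ρ < 3 →
  maxEdges (sliceBound q ρ 0F) + maxEdges (sliceBound q ρ 1F) + maxEdges (sliceBound q ρ 2F)
    + pairMins (sliceBound q ρ 0F) (sliceBound q ρ 1F) (sliceBound q ρ 2F)
  ≡ maxEdges (thrice q + ρ)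
maxEdges-sliceBounds q zero _
  rewrite +-identityʳ q | ⊓-idem q = sym (maxEdges-thrice+ q 0 z<s)
maxEdges-sliceBounds q (suc zero) _
  rewrite +-identityʳ q | +-comm q 1 | m≥n⇒m⊓n≡n (n≤1+n q) | ⊓-idem q = sym (maxEdges-thrice+ q 1 (s<s z<s))
maxEdges-sliceBounds q (suc (suc zero)) _
  rewrite +-identityʳ q | +-comm q 1 | ⊓-idem q | m≥n⇒m⊓n≡n (n≤1+n q) = sym (maxEdges-thrice+ q 2 (s<s (s<s z<s)))
maxEdges-sliceBounds q (suc (suc (suc ρ))) (s≤s (s≤s (s≤s ())))

<ᵇ∧<ᵇ≡<ᵇ⊓ : ∀ r a b → (r <ᵇ a) ∧ (r <ᵇ b) ≡ (r <ᵇ a ⊓ b)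
<ᵇ∧<ᵇ≡<ᵇ⊓ r a b = T-extensional
  (λ t → <⇒<ᵇ (⊓-glb (<ᵇ⇒< r a (proj₁ (T-∧-elim t))) (<ᵇ⇒< r b (proj₂ (T-∧-elim t)))))
  (λ t → T-∧-intro (<⇒<ᵇ (m<n⊓o⇒m<n a b (<ᵇ⇒< r _ t))) (<⇒<ᵇ (m<n⊓o⇒m<o a b (<ᵇ⇒< r _ t))))

module LexSlices (n m : ℕ) (m≤ : m ≤ 3 ^ suc n) where

  q = div3 m
  ρ = mod3 m

  split : m ≡ thrice q + ρ
  split = thrice-div3+mod3 m

  slice : Fin 3 → Vertex n → Bool
  slice i w = lexBelow m (i ∷ w)

  slice≡ : ∀ i w → slice i w ≡ lexBelow (sliceBound q ρ i) w
  slice≡ i w = trans (cong (λ u → lexBelow u (i ∷ w)) split) (lexBelow-∷ q ρ i w (mod3<3 m))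

  sliceBound≤3^ : ∀ i → sliceBound q ρ i ≤ 3 ^ n
  sliceBound≤3^ i = sliceBound≤ q ρ (3 ^ n) i
    (subst₂ _≤_ split (3^suc≡thrice n) m≤)

size-lex : ∀ n m → m ≤ 3 ^ n → size n (lexBelow m) ≡ m
size-lex zero zero _ = refl
size-lex zero (suc zero) _ = refl
size-lex zero (suc (suc m)) (s≤s ())
size-lex (suc n) m m≤ = begin
    size (suc n) (lexBelow m)
  ≡⟨ vertexSum-suc n _ ⟩
    size n (slice 0F) + size n (slice 1F) + size n (slice 2F)
  ≡⟨ cong₂ _+_ (cong₂ _+_ (size-slice 0F) (size-slice 1F)) (size-slice 2F) ⟩
    sliceBound q ρ 0F + sliceBound q ρ 1F + sliceBound q ρ 2F
  ≡⟨ sliceBounds-sum q ρ (mod3<3 m) ⟩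
    thrice q + ρ
  ≡⟨ sym split ⟩
    m ∎
  where
  open ≡-Reasoning
  open LexSlices n m m≤
  size-slice : ∀ i → size n (slice i) ≡ sliceBound q ρ i
  size-slice i = trans (vertexSum-cong n (λ w → cong ⟦_⟧ (slice≡ i w)))
                       (size-lex n (sliceBound q ρ i) (sliceBound≤3^ i))

inner-lex : ∀ n m → m ≤ 3 ^ n → inner n (lexBelow m) ≡ maxEdges m
inner-lex zero zero _ = refl
inner-lex zero (suc zero) _ = refl
inner-lex zero (suc (suc m)) (s≤s ())
inner-lex (suc n) m m≤ = begin
    inner (suc n) (lexBelow m)
  ≡⟨ edgeSum-suc n _ ⟩
    inner n (slice 0F) + inner n (slice 1F) + inner n (slice 2F)
      + vertexSum n (λ x → ⟦ slice 0F x ∧ slice 1F x ⟧ + ⟦ slice 0F x ∧ slice 2F x ⟧ + ⟦ slice 1F x ∧ slice 2F x ⟧)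
  ≡⟨ cong₂ _+_ (cong₂ _+_ (cong₂ _+_ (inner-slice 0F) (inner-slice 1F)) (inner-slice 2F))
               (trans (vertexSum-+ n _ _) (cong₂ _+_ (trans (vertexSum-+ n _ _)
                 (cong₂ _+_ (common 0F 1F) (common 0F 2F))) (common 1F 2F))) ⟩
    maxEdges (b 0F) + maxEdges (b 1F) + maxEdges (b 2F) + pairMins (b 0F) (b 1F) (b 2F)
  ≡⟨ maxEdges-sliceBounds q ρ (mod3<3 m) ⟩
    maxEdges (thrice q + ρ)
  ≡⟨ cong maxEdges (sym split) ⟩
    maxEdges m ∎
  where
  open ≡-Reasoning
  open LexSlices n m m≤
  b = sliceBound q ρ
  inner-slice : ∀ i → inner n (slice i) ≡ maxEdges (b i)
  inner-slice i = trans (edgeSum-cong n (λ e → cong ⟦_⟧ (cong₂ _∧_ (slice≡ i (proj₁ e)) (slice≡ i (proj₂ e)))))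
                        (inner-lex n (b i) (sliceBound≤3^ i))
  common : ∀ i j → vertexSum n (λ x → ⟦ slice i x ∧ slice j x ⟧) ≡ b i ⊓ b j
  common i j = trans (vertexSum-cong n (λ x → cong ⟦_⟧ (trans (cong₂ _∧_ (slice≡ i x) (slice≡ j x))
                                                               (<ᵇ∧<ᵇ≡<ᵇ⊓ (rank x) (b i) (b j)))))
                     (size-lex n (b i ⊓ b j) (≤-trans (m⊓n≤m (b i) (b j)) (sliceBound≤3^ i)))

cut-lex : ∀ n m → m ≤ 3 ^ n → cut n (lexBelow m) + 2 * maxEdges m ≡ (n + n) * m
cut-lex n m m≤ = begin
    cut n (lexBelow m) + 2 * maxEdges m
  ≡⟨ cong (λ u → cut n (lexBelow m) + 2 * u) (sym (inner-lex n m m≤)) ⟩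
    cut n (lexBelow m) + 2 * inner n (lexBelow m)
  ≡⟨ cut+2*inner n (lexBelow m) ⟩
    (n + n) * size n (lexBelow m)
  ≡⟨ cong ((n + n) *_) (size-lex n m m≤) ⟩
    (n + n) * m ∎
  where open ≡-Reasoning

cut-complement : ∀ n P → cut n (λ v → not (P v)) ≡ cut n P
cut-complement n P = edgeSum-cong n (λ e → cong ⟦_⟧ (not-xor-not (P (proj₁ e)) (P (proj₂ e))))
  where
  not-xor-not : ∀ a b → (not a xor not b) ≡ (a xor b)
  not-xor-not true b = refl
  not-xor-not false b = not-involutive b

halfPow3 : ℕ → ℕ
halfPow3 zero = 0
halfPow3 (suc n) = thrice (halfPow3 n) + 1

3^≡1+2*halfPow3 : ∀ n → 3 ^ n ≡ suc (halfPow3 n + halfPow3 n)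
3^≡1+2*halfPow3 zero = refl
3^≡1+2*halfPow3 (suc n) rewrite 3^≡1+2*halfPow3 n = ring (halfPow3 n)
  where
  ring : ∀ k → 3 * suc (k + k) ≡ suc (k + k + k + 1 + (k + k + k + 1))
  ring = solve-∀

⌊3^/2⌋≡halfPow3 : ∀ n → ⌊ 3 ^ n /2⌋ ≡ halfPow3 n
⌊3^/2⌋≡halfPow3 n rewrite 3^≡1+2*halfPow3 n = sym (n≡⌈n+n/2⌉ (halfPow3 n))

⌈3^/2⌉≡1+halfPow3 : ∀ n → ⌈ 3 ^ n /2⌉ ≡ suc (halfPow3 n)
⌈3^/2⌉≡1+halfPow3 n rewrite 3^≡1+2*halfPow3 n = cong suc (sym (n≡⌊n+n/2⌋ (halfPow3 n)))

maxEdges-halfPow3 : ∀ n → maxEdges (halfPow3 n) + halfPow3 n ≡ n * halfPow3 n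
maxEdges-1+halfPow3 : ∀ n → maxEdges (suc (halfPow3 n)) ≡ maxEdges (halfPow3 n) + n

maxEdges-halfPow3 zero = refl
maxEdges-halfPow3 (suc n) = begin
    maxEdges (thrice k + 1) + (thrice k + 1)
  ≡⟨ cong (_+ (thrice k + 1)) (maxEdges-thrice+ k 1 (s<s z<s)) ⟩
    maxEdges (suc k) + maxEdges k + maxEdges k + thrice k + (thrice k + 1)
  ≡⟨ cong (λ u → u + maxEdges k + maxEdges k + thrice k + (thrice k + 1)) (maxEdges-1+halfPow3 n) ⟩
    maxEdges k + n + maxEdges k + maxEdges k + thrice k + (thrice k + 1)
  ≡⟨ ring₁ (maxEdges k) k n ⟩
    3 * (maxEdges k + k) + (thrice k + n + 1)
  ≡⟨ cong (λ u → 3 * u + (thrice k + n + 1)) (maxEdges-halfPow3 n) ⟩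
    3 * (n * k) + (thrice k + n + 1)
  ≡⟨ ring₂ n k ⟩
    suc n * (thrice k + 1) ∎
  where
  open ≡-Reasoning
  k = halfPow3 n
  ring₁ : ∀ H k n → H + n + H + H + (k + k + k) + (k + k + k + 1) ≡ 3 * (H + k) + (k + k + k + n + 1)
  ring₁ = solve-∀
  ring₂ : ∀ n k → 3 * (n * k) + (k + k + k + n + 1) ≡ suc n * (k + k + k + 1)
  ring₂ = solve-∀

maxEdges-1+halfPow3 zero = refl
maxEdges-1+halfPow3 (suc n) = begin
    maxEdges (suc (thrice k + 1))
  ≡⟨ cong maxEdges (sym (+-suc (thrice k) 1)) ⟩
    maxEdges (thrice k + 2)
  ≡⟨ maxEdges-thrice+ k 2 (s<s (s<s z<s)) ⟩
    maxEdges (suc k) + maxEdges (suc k) + maxEdges k + suc (thrice k)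
  ≡⟨ cong (λ u → u + u + maxEdges k + suc (thrice k)) (maxEdges-1+halfPow3 n) ⟩
    maxEdges k + n + (maxEdges k + n) + maxEdges k + suc (thrice k)
  ≡⟨ ring (maxEdges k) (thrice k) n ⟩
    maxEdges k + n + maxEdges k + maxEdges k + thrice k + suc n
  ≡⟨ cong (λ u → u + maxEdges k + maxEdges k + thrice k + suc n) (sym (maxEdges-1+halfPow3 n)) ⟩
    maxEdges (suc k) + maxEdges k + maxEdges k + thrice k + suc n
  ≡⟨ cong (_+ suc n) (sym (maxEdges-thrice+ k 1 (s<s z<s))) ⟩
    maxEdges (thrice k + 1) + suc n ∎
  where
  open ≡-Reasoning
  k = halfPow3 n
  ring : ∀ H T n → H + n + (H + n) + H + suc T ≡ H + n + H + H + T + suc n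
  ring = solve-∀

-- The cuts of the lexicographic sets of sizes K - 1, K, K + 1, K + 2, where K = halfPow3 n,
-- in the form (n + n) * s ≡ 2 * maxEdges s + cut (see cut-lex).

boundary-halfPow3 : ∀ n → (n + n) * halfPow3 n ≡ 2 * maxEdges (halfPow3 n) + (halfPow3 n + halfPow3 n)
boundary-halfPow3 n = begin
    (n + n) * K
  ≡⟨ ring₁ n K ⟩
    n * K + n * K
  ≡⟨ cong₂ _+_ (sym (maxEdges-halfPow3 n)) (sym (maxEdges-halfPow3 n)) ⟩
    (maxEdges K + K) + (maxEdges K + K)
  ≡⟨ ring₂ (maxEdges K) K ⟩
    2 * maxEdges K + (K + K) ∎
  where
  open ≡-Reasoning
  K = halfPow3 n
  ring₁ : ∀ n K → (n + n) * K ≡ n * K + n * K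
  ring₁ = solve-∀
  ring₂ : ∀ H K → (H + K) + (H + K) ≡ 2 * H + (K + K)
  ring₂ = solve-∀

boundary-1+halfPow3 : ∀ n → (n + n) * suc (halfPow3 n) ≡ 2 * maxEdges (suc (halfPow3 n)) + (halfPow3 n + halfPow3 n)
boundary-1+halfPow3 n = begin
    (n + n) * suc K
  ≡⟨ ring₁ n K ⟩
    n * K + n * K + (n + n)
  ≡⟨ cong (λ u → u + u + (n + n)) (sym (maxEdges-halfPow3 n)) ⟩
    maxEdges K + K + (maxEdges K + K) + (n + n)
  ≡⟨ ring₂ (maxEdges K) K n ⟩
    2 * (maxEdges K + n) + (K + K)
  ≡⟨ cong (λ u → 2 * u + (K + K)) (sym (maxEdges-1+halfPow3 n)) ⟩
    2 * maxEdges (suc K) + (K + K) ∎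
  where
  open ≡-Reasoning
  K = halfPow3 n
  ring₁ : ∀ n K → (n + n) * suc K ≡ n * K + n * K + (n + n)
  ring₁ = solve-∀
  ring₂ : ∀ H K n → H + K + (H + K) + (n + n) ≡ 2 * (H + n) + (K + K)
  ring₂ = solve-∀

boundary-halfPow3-1 : ∀ n → (suc n + suc n) * thrice (halfPow3 n)
                          ≡ 2 * maxEdges (thrice (halfPow3 n)) + (thrice (halfPow3 n) + thrice (halfPow3 n))
boundary-halfPow3-1 n = begin
    (suc n + suc n) * thrice k
  ≡⟨ ring₁ n k ⟩
    6 * (n * k) + 6 * k
  ≡⟨ cong (λ u → 6 * u + 6 * k) (sym (maxEdges-halfPow3 n)) ⟩
    6 * (maxEdges k + k) + 6 * k
  ≡⟨ ring₂ (maxEdges k) k ⟩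
    2 * (maxEdges k + maxEdges k + maxEdges k + thrice k) + (thrice k + thrice k)
  ≡⟨ cong (λ u → 2 * u + (thrice k + thrice k)) (sym (trans (cong maxEdges (sym (+-identityʳ (thrice k))))
                                                             (maxEdges-thrice+ k 0 z<s))) ⟩
    2 * maxEdges (thrice k) + (thrice k + thrice k) ∎
  where
  open ≡-Reasoning
  k = halfPow3 n
  ring₁ : ∀ n k → (suc n + suc n) * (k + k + k) ≡ 6 * (n * k) + 6 * k
  ring₁ = solve-∀
  ring₂ : ∀ H k → 6 * (H + k) + 6 * k ≡ 2 * (H + H + H + (k + k + k)) + ((k + k + k) + (k + k + k))
  ring₂ = solve-∀

boundary-2+halfPow3 : ∀ n → (suc n + suc n) * suc (suc (halfPow3 (suc n)))
                          ≡ 2 * maxEdges (suc (suc (halfPow3 (suc n)))) + (thrice (halfPow3 n) + thrice (halfPow3 n))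
boundary-2+halfPow3 n = begin
    (suc n + suc n) * suc (suc (thrice k + 1))
  ≡⟨ ring₁ n k ⟩
    6 * (n * k) + 6 * n + 6 * k + 6
  ≡⟨ cong (λ u → 6 * u + 6 * n + 6 * k + 6) (sym (maxEdges-halfPow3 n)) ⟩
    6 * (maxEdges k + k) + 6 * n + 6 * k + 6
  ≡⟨ ring₂ (maxEdges k) k n ⟩
    2 * ((maxEdges k + n) + (maxEdges k + n) + (maxEdges k + n) + thrice (suc k)) + (thrice k + thrice k)
  ≡⟨ cong (λ u → 2 * (u + u + u + thrice (suc k)) + (thrice k + thrice k)) (sym (maxEdges-1+halfPow3 n)) ⟩
    2 * (maxEdges (suc k) + maxEdges (suc k) + maxEdges (suc k) + thrice (suc k)) + (thrice k + thrice k)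
  ≡⟨ cong (λ u → 2 * u + (thrice k + thrice k)) (sym (trans (cong maxEdges (ring₃ k)) (maxEdges-thrice+ (suc k) 0 z<s))) ⟩
    2 * maxEdges (suc (suc (thrice k + 1))) + (thrice k + thrice k) ∎
  where
  open ≡-Reasoning
  k = halfPow3 n
  ring₁ : ∀ n k → (suc n + suc n) * suc (suc (k + k + k + 1)) ≡ 6 * (n * k) + 6 * n + 6 * k + 6
  ring₁ = solve-∀
  ring₂ : ∀ H k n → 6 * (H + k) + 6 * n + 6 * k + 6
                  ≡ 2 * ((H + n) + (H + n) + (H + n) + (suc k + suc k + suc k)) + ((k + k + k) + (k + k + k))
  ring₂ = solve-∀
  ring₃ : ∀ k → suc (suc (k + k + k + 1)) ≡ suc k + suc k + suc k + 0
  ring₃ = solve-∀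

-- The banana tree and its path metric

-- The banana tree B_{2,m+2}, rooted at root: linkA is the leaf of the first star joined to the root,
-- centreA its centre and leafA i (i < m) its other leaves; likewise for the second star.
data Node : Set where
  root linkA centreA linkB centreB : Node
  leafA leafB : ℕ → Node

-- inSubtree x y: y lies in the subtree below x.
inSubtree : Node → Node → Bool
inSubtree root y = false
inSubtree linkA linkA = true
inSubtree linkA centreA = true
inSubtree linkA (leafA _) = true
inSubtree linkA _ = false
inSubtree centreA centreA = true
inSubtree centreA (leafA _) = true
inSubtree centreA _ = false
inSubtree (leafA i) (leafA j) = i ≡ᵇ j
inSubtree (leafA i) _ = false
inSubtree linkB linkB = true
inSubtree linkB centreB = true
inSubtree linkB (leafB _) = true
inSubtree linkB _ = false
inSubtree centreB centreB = true
inSubtree centreB (leafB _) = true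
inSubtree centreB _ = false
inSubtree (leafB i) (leafB j) = i ≡ᵇ j
inSubtree (leafB i) _ = false

sameNode : Node → Node → Bool
sameNode root root = true
sameNode linkA linkA = true
sameNode centreA centreA = true
sameNode (leafA i) (leafA j) = i ≡ᵇ j
sameNode linkB linkB = true
sameNode centreB centreB = true
sameNode (leafB i) (leafB j) = i ≡ᵇ j
sameNode _ _ = false

sameNode-sound : ∀ x y → T (sameNode x y) → x ≡ y
sameNode-sound root root _ = refl
sameNode-sound linkA linkA _ = refl
sameNode-sound centreA centreA _ = refl
sameNode-sound (leafA i) (leafA j) t = cong leafA (≡ᵇ⇒≡ i j t)
sameNode-sound linkB linkB _ = refl
sameNode-sound centreB centreB _ = refl
sameNode-sound (leafB i) (leafB j) t = cong leafB (≡ᵇ⇒≡ i j t)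

-- Node has a leaf for every index; Valid m picks out the nodes of B_{2,m+2}.
Valid : ℕ → Node → Set
Valid m (leafA i) = i < m
Valid m (leafB i) = i < m
Valid m _ = ⊤

data TreeEdge (m : ℕ) : Node → Node → Set where
  root-linkA : TreeEdge m root linkA
  linkA-centreA : TreeEdge m linkA centreA
  centreA-leafA : ∀ i → i < m → TreeEdge m centreA (leafA i)
  root-linkB : TreeEdge m root linkB
  linkB-centreB : TreeEdge m linkB centreB
  centreB-leafB : ∀ i → i < m → TreeEdge m centreB (leafB i)

-- Along a tree edge from p down to c, only the subtree below c itself separates p from c.
Crossing : Node → Node → Node → Set
Crossing p c x = (inSubtree x c ≡ inSubtree x p × sameNode x c ≡ false)
                ⊎ (inSubtree x c ≡ true × inSubtree x p ≡ false × sameNode x c ≡ true)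

crossing-leafA : ∀ i j → Crossing centreA (leafA i) (leafA j)
crossing-leafA i j with j ≡ᵇ i
... | true = inj₂ (refl , refl , refl)
... | false = inj₁ (refl , refl)

crossing-leafB : ∀ i j → Crossing centreB (leafB i) (leafB j)
crossing-leafB i j with j ≡ᵇ i
... | true = inj₂ (refl , refl , refl)
... | false = inj₁ (refl , refl)

crossing : ∀ {m p c} → TreeEdge m p c → ∀ x → Crossing p c x
crossing root-linkA root = inj₁ (refl , refl)
crossing root-linkA linkA = inj₂ (refl , refl , refl)
crossing root-linkA centreA = inj₁ (refl , refl)
crossing root-linkA (leafA i) = inj₁ (refl , refl)
crossing root-linkA linkB = inj₁ (refl , refl)
crossing root-linkA centreB = inj₁ (refl , refl)
crossing root-linkA (leafB i) = inj₁ (refl , refl)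
crossing linkA-centreA root = inj₁ (refl , refl)
crossing linkA-centreA linkA = inj₁ (refl , refl)
crossing linkA-centreA centreA = inj₂ (refl , refl , refl)
crossing linkA-centreA (leafA i) = inj₁ (refl , refl)
crossing linkA-centreA linkB = inj₁ (refl , refl)
crossing linkA-centreA centreB = inj₁ (refl , refl)
crossing linkA-centreA (leafB i) = inj₁ (refl , refl)
crossing (centreA-leafA i _) root = inj₁ (refl , refl)
crossing (centreA-leafA i _) linkA = inj₁ (refl , refl)
crossing (centreA-leafA i _) centreA = inj₁ (refl , refl)
crossing (centreA-leafA i _) (leafA j) = crossing-leafA i j
crossing (centreA-leafA i _) linkB = inj₁ (refl , refl)
crossing (centreA-leafA i _) centreB = inj₁ (refl , refl)
crossing (centreA-leafA i _) (leafB j) = inj₁ (refl , refl)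
crossing root-linkB root = inj₁ (refl , refl)
crossing root-linkB linkA = inj₁ (refl , refl)
crossing root-linkB centreA = inj₁ (refl , refl)
crossing root-linkB (leafA i) = inj₁ (refl , refl)
crossing root-linkB linkB = inj₂ (refl , refl , refl)
crossing root-linkB centreB = inj₁ (refl , refl)
crossing root-linkB (leafB i) = inj₁ (refl , refl)
crossing linkB-centreB root = inj₁ (refl , refl)
crossing linkB-centreB linkA = inj₁ (refl , refl)
crossing linkB-centreB centreA = inj₁ (refl , refl)
crossing linkB-centreB (leafA i) = inj₁ (refl , refl)
crossing linkB-centreB linkB = inj₁ (refl , refl)
crossing linkB-centreB centreB = inj₂ (refl , refl , refl)
crossing linkB-centreB (leafB i) = inj₁ (refl , refl)
crossing (centreB-leafB i _) root = inj₁ (refl , refl)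
crossing (centreB-leafB i _) linkA = inj₁ (refl , refl)
crossing (centreB-leafB i _) centreA = inj₁ (refl , refl)
crossing (centreB-leafB i _) (leafA j) = inj₁ (refl , refl)
crossing (centreB-leafB i _) linkB = inj₁ (refl , refl)
crossing (centreB-leafB i _) centreB = inj₁ (refl , refl)
crossing (centreB-leafB i _) (leafB j) = crossing-leafB i j

separates : Node → Node → Node → ℕ
separates x u v = ⟦ inSubtree x u xor inSubtree x v ⟧

⟦xor⟧-triangle : ∀ a b c → ⟦ a xor c ⟧ ≤ ⟦ a xor b ⟧ + ⟦ b xor c ⟧
⟦xor⟧-triangle true true true = z≤n
⟦xor⟧-triangle true true false = s≤s z≤n
⟦xor⟧-triangle true false true = z≤n
⟦xor⟧-triangle true false false = s≤s z≤n
⟦xor⟧-triangle false true true = s≤s z≤n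
⟦xor⟧-triangle false true false = z≤n
⟦xor⟧-triangle false false true = s≤s z≤n
⟦xor⟧-triangle false false false = z≤n

separates-child≤ : ∀ {m p c} → TreeEdge m p c → ∀ x u → separates x u c ≤ separates x u p + ⟦ sameNode x c ⟧
separates-child≤ t x u with crossing t x
... | inj₁ (e , q) rewrite e | q = m≤m+n _ 0
... | inj₂ (e , e' , q) rewrite e | e' | q = ≤-trans (⟦xor⟧-triangle (inSubtree x u) false true) ≤-refl

separates-parent≤ : ∀ {m p c} → TreeEdge m p c → ∀ x u → separates x u p ≤ separates x u c + ⟦ sameNode x c ⟧
separates-parent≤ t x u with crossing t x
... | inj₁ (e , q) rewrite e | q = m≤m+n _ 0
... | inj₂ (e , e' , q) rewrite e | e' | q = ≤-trans (⟦xor⟧-triangle (inSubtree x u) true false) ≤-refl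

separates-child≡ : ∀ {m p c} → TreeEdge m p c → ∀ u → inSubtree c u ≡ false →
                   ∀ x → separates x u c ≡ separates x u p + ⟦ sameNode x c ⟧
separates-child≡ t u f x with crossing t x
... | inj₁ (e , q) rewrite e | q = sym (+-identityʳ _)
... | inj₂ (e , e' , q) with sameNode-sound x _ (subst T (sym q) tt)
...   | refl rewrite e | e' | q | f = refl

separates-parent≡ : ∀ {m p c} → TreeEdge m p c → ∀ u → inSubtree c u ≡ true →
                    ∀ x → separates x u p ≡ separates x u c + ⟦ sameNode x c ⟧
separates-parent≡ t u f x with crossing t x
... | inj₁ (e , q) rewrite e | q = sym (+-identityʳ _)
... | inj₂ (e , e' , q) with sameNode-sound x _ (subst T (sym q) tt)
...   | refl rewrite e | e' | q | f = refl

rangeSum : (ℕ → ℕ) → ℕ → ℕ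
rangeSum φ zero = 0
rangeSum φ (suc l) = rangeSum φ l + φ l

rangeSum-cons : ∀ φ l → rangeSum φ (suc l) ≡ φ 0 + rangeSum (φ ∘ suc) l
rangeSum-cons φ zero = +-comm 0 (φ 0)
rangeSum-cons φ (suc l) rewrite rangeSum-cons φ l = +-assoc (φ 0) (rangeSum (φ ∘ suc) l) (φ (suc l))

rangeSum-+ᵣ : ∀ φ a b → rangeSum φ (a + b) ≡ rangeSum φ a + rangeSum (λ i → φ (a + i)) b
rangeSum-+ᵣ φ a zero rewrite +-identityʳ a = sym (+-identityʳ _)
rangeSum-+ᵣ φ a (suc b) rewrite +-suc a b | rangeSum-+ᵣ φ a b = +-assoc (rangeSum φ a) _ _

rangeSum-cong : ∀ {φ ψ} l → (∀ i → i < l → φ i ≡ ψ i) → rangeSum φ l ≡ rangeSum ψ l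
rangeSum-cong zero e = refl
rangeSum-cong (suc l) e = cong₂ _+_ (rangeSum-cong l (λ i p → e i (≤-trans p (n≤1+n l)))) (e l ≤-refl)

rangeSum-+ : ∀ φ ψ l → rangeSum (λ i → φ i + ψ i) l ≡ rangeSum φ l + rangeSum ψ l
rangeSum-+ φ ψ zero = refl
rangeSum-+ φ ψ (suc l) rewrite rangeSum-+ φ ψ l = ring (rangeSum φ l) (rangeSum ψ l) (φ l) (ψ l)
  where
  ring : ∀ a b c d → a + b + (c + d) ≡ a + c + (b + d)
  ring = solve-∀

rangeSum-mono : ∀ {φ ψ} l → (∀ i → i < l → φ i ≤ ψ i) → rangeSum φ l ≤ rangeSum ψ l
rangeSum-mono zero e = z≤n
rangeSum-mono (suc l) e = +-mono-≤ (rangeSum-mono l (λ i i<l → e i (m<n⇒m<1+n i<l))) (e l ≤-refl)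

rangeSum-const : ∀ c l → rangeSum (λ _ → c) l ≡ l * c
rangeSum-const c zero = refl
rangeSum-const c (suc l) rewrite rangeSum-const c l = +-comm (l * c) c

⟦≡ᵇ⟧≡0 : ∀ {a b} → a ≢ b → ⟦ a ≡ᵇ b ⟧ ≡ 0
⟦≡ᵇ⟧≡0 {a} {b} a≢b = cong ⟦_⟧ (¬T⇒≡false (λ t → a≢b (≡ᵇ⇒≡ a b t)))

rangeSum-δ : ∀ l j → j < l → rangeSum (λ i → ⟦ i ≡ᵇ j ⟧) l ≡ 1
rangeSum-δ (suc l) j j<1+l with <-cmp j l
... | tri< j<l _ _ = cong₂ _+_ (rangeSum-δ l j j<l) (⟦≡ᵇ⟧≡0 (λ l≡j → <-irrefl (sym l≡j) j<l))
... | tri≈ _ refl _ = cong₂ _+_ (trans (rangeSum-cong l (λ i i<l → ⟦≡ᵇ⟧≡0 (<⇒≢ i<l)))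
                                      (trans (rangeSum-const 0 l) (*-zeroʳ l)))
                               (cong ⟦_⟧ (≡ᵇ-refl j))
... | tri> _ _ l<j = ⊥-elim (<-irrefl refl (≤-trans (s≤s l<j) j<1+l))

nodeSum : ℕ → (Node → ℕ) → ℕ
nodeSum m φ = φ root + φ linkA + φ centreA + rangeSum (φ ∘ leafA) m + φ linkB + φ centreB + rangeSum (φ ∘ leafB) m

nodeSum-+ : ∀ m φ ψ → nodeSum m (λ x → φ x + ψ x) ≡ nodeSum m φ + nodeSum m ψ
nodeSum-+ m φ ψ rewrite rangeSum-+ (φ ∘ leafA) (ψ ∘ leafA) m | rangeSum-+ (φ ∘ leafB) (ψ ∘ leafB) m =
  ring (φ root) (ψ root) (φ linkA) (ψ linkA) (φ centreA) (ψ centreA) (rangeSum (φ ∘ leafA) m) (rangeSum (ψ ∘ leafA) m)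
       (φ linkB) (ψ linkB) (φ centreB) (ψ centreB) (rangeSum (φ ∘ leafB) m) (rangeSum (ψ ∘ leafB) m)
  where
  ring : ∀ a a′ b b′ c c′ d d′ e e′ f f′ g g′ →
         a + a′ + (b + b′) + (c + c′) + (d + d′) + (e + e′) + (f + f′) + (g + g′)
         ≡ a + b + c + d + e + f + g + (a′ + b′ + c′ + d′ + e′ + f′ + g′)
  ring = solve-∀

nodeSum-mono : ∀ m {φ ψ} → (∀ x → Valid m x → φ x ≤ ψ x) → nodeSum m φ ≤ nodeSum m ψ
nodeSum-mono m e =
  +-mono-≤ (+-mono-≤ (+-mono-≤ (+-mono-≤ (+-mono-≤ (+-mono-≤ (e root tt) (e linkA tt)) (e centreA tt))
    (rangeSum-mono m (e ∘ leafA))) (e linkB tt)) (e centreB tt)) (rangeSum-mono m (e ∘ leafB))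

nodeSum-cong : ∀ m {φ ψ} → (∀ x → φ x ≡ ψ x) → nodeSum m φ ≡ nodeSum m ψ
nodeSum-cong m e = ≤-antisym (nodeSum-mono m (λ x _ → ≤-reflexive (e x))) (nodeSum-mono m (λ x _ → ≤-reflexive (sym (e x))))

nodeSum-0 : ∀ m → nodeSum m (λ _ → 0) ≡ 0
nodeSum-0 m rewrite rangeSum-const 0 m | *-zeroʳ m = refl

nodeSum-1 : ∀ m → nodeSum m (λ _ → 1) ≡ 3 + (m + (2 + m))
nodeSum-1 m rewrite rangeSum-const 1 m | *-identityʳ m = ring m
  where
  ring : ∀ m → 1 + 1 + 1 + m + 1 + 1 + m ≡ 3 + (m + (2 + m))
  ring = solve-∀

nodeSum-δ : ∀ m c → Valid m c → nodeSum m (λ x → ⟦ sameNode x c ⟧) ≡ 1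
nodeSum-δ m root _ rewrite rangeSum-const 0 m | *-zeroʳ m = refl
nodeSum-δ m linkA _ rewrite rangeSum-const 0 m | *-zeroʳ m = refl
nodeSum-δ m centreA _ rewrite rangeSum-const 0 m | *-zeroʳ m = refl
nodeSum-δ m (leafA j) v rewrite rangeSum-const 0 m | *-zeroʳ m | rangeSum-δ m j v = refl
nodeSum-δ m linkB _ rewrite rangeSum-const 0 m | *-zeroʳ m = refl
nodeSum-δ m centreB _ rewrite rangeSum-const 0 m | *-zeroʳ m = refl
nodeSum-δ m (leafB j) v rewrite rangeSum-const 0 m | *-zeroʳ m | rangeSum-δ m j v = refl

nodeSum-swap : ∀ {A : Set} m (F : A → Node → ℕ) (xs : List A) →
               sumMap (λ e → nodeSum m (F e)) xs ≡ nodeSum m (λ x → sumMap (λ e → F e x) xs)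
nodeSum-swap m F [] = sym (nodeSum-0 m)
nodeSum-swap m F (e ∷ xs) rewrite nodeSum-swap m F xs = sym (nodeSum-+ m (F e) (λ x → sumMap (λ e → F e x) xs))

decodeB : ℕ → Node
decodeB zero = linkB
decodeB (suc zero) = centreB
decodeB (suc (suc j)) = leafB j

-- The numbering of the nodes used by bananaAdj.
decode : ℕ → ℕ → Node
decode m zero = root
decode m (suc zero) = linkA
decode m (suc (suc zero)) = centreA
decode m (suc (suc (suc i))) = if i <ᵇ m then leafA i else decodeB (i ∸ m)

encode : ℕ → Node → ℕ
encode m root = 0
encode m linkA = 1
encode m centreA = 2
encode m (leafA i) = 3 + i
encode m linkB = 3 + m
encode m centreB = 4 + m
encode m (leafB j) = 5 + m + j

nodeCount : ℕ → ℕ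
nodeCount m = 3 + (m + (2 + m))

decode-leafA : ∀ m i → i < m → decode m (3 + i) ≡ leafA i
decode-leafA m i lt rewrite T⇒≡true (<⇒<ᵇ lt) = refl

decode-B : ∀ m j → decode m (3 + (m + j)) ≡ decodeB j
decode-B m j rewrite ¬T⇒≡false {m + j <ᵇ m} (λ t → <-irrefl refl (≤-trans (<ᵇ⇒< _ _ t) (m≤m+n m j))) | m+n∸m≡n m j = refl

decode-encode : ∀ m x → Valid m x → decode m (encode m x) ≡ x
decode-encode m root _ = refl
decode-encode m linkA _ = refl
decode-encode m centreA _ = refl
decode-encode m (leafA i) v = decode-leafA m i v
decode-encode m linkB _ = trans (cong (decode m) (cong (3 +_) (sym (+-identityʳ m)))) (decode-B m 0)
decode-encode m centreB _ = trans (cong (decode m) (cong (3 +_) (sym (+-comm m 1)))) (decode-B m 1)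
decode-encode m (leafB j) _ = trans (cong (decode m) (cong (3 +_) (ring m j))) (decode-B m (2 + j))
  where
  ring : ∀ m j → 2 + m + j ≡ m + (2 + j)
  ring = solve-∀

encode< : ∀ m x → Valid m x → encode m x < nodeCount m
encode< m root _ = s≤s z≤n
encode< m linkA _ = s≤s (s≤s z≤n)
encode< m centreA _ = s≤s (s≤s (s≤s z≤n))
encode< m (leafA i) v = s≤s (s≤s (s≤s (≤-trans v (m≤m+n m _))))
encode< m linkB _ = s≤s (s≤s (s≤s (≤-trans (≤-reflexive (+-comm 1 m)) (+-monoʳ-≤ m (s≤s z≤n)))))
encode< m centreB _ = s≤s (s≤s (s≤s (≤-trans (≤-reflexive (+-comm 2 m)) (+-monoʳ-≤ m (s≤s (s≤s z≤n))))))
encode< m (leafB j) v = s≤s (s≤s (s≤s (≤-trans (≤-reflexive (ring m j)) (+-monoʳ-≤ m (s≤s (s≤s v))))))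
  where
  ring : ∀ m j → suc (suc (suc (m + j))) ≡ m + (2 + suc j)
  ring = solve-∀

encode-decode : ∀ m a → a < nodeCount m → (encode m (decode m a) ≡ a) × Valid m (decode m a)
encode-decode m zero _ = refl , tt
encode-decode m (suc zero) _ = refl , tt
encode-decode m (suc (suc zero)) _ = refl , tt
encode-decode m (suc (suc (suc i))) lt with i <ᵇ m in e
... | true = refl , <ᵇ⇒< i m (subst T (sym e) tt)
... | false = sideB (i ∸ m) (sym (m+[n∸m]≡n {m} {i} m≤i))
  where
  m≤i : m ≤ i
  m≤i = ≮⇒≥ (λ i<m → subst T e (<⇒<ᵇ i<m))
  sideB : ∀ j → i ≡ m + j → (encode m (decodeB j) ≡ suc (suc (suc i))) × Valid m (decodeB j)
  sideB zero i≡ = cong (3 +_) (trans (sym (+-identityʳ m)) (sym i≡)) , tt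
  sideB (suc zero) i≡ = cong (3 +_) (trans (+-comm 1 m) (sym i≡)) , tt
  sideB (suc (suc j)) i≡ = cong (3 +_) (trans (ring₁ m j) (sym i≡)) ,
    +-cancelˡ-< (suc (suc m)) j m (begin
      suc (suc (suc m) + j)    ≡⟨ ring₂ m j ⟩
      suc (m + suc (suc j))    ≡⟨ cong suc (sym i≡) ⟩
      suc i                    ≤⟨ ≤-pred (≤-pred (≤-pred lt)) ⟩
      m + (2 + m)              ≡⟨ ring₃ m ⟩
      suc (suc m) + m          ∎)
    where
    open ≤-Reasoning
    ring₁ : ∀ m j → 2 + m + j ≡ m + suc (suc j)
    ring₁ = solve-∀
    ring₂ : ∀ m j → suc (suc (suc m) + j) ≡ suc (m + suc (suc j))
    ring₂ = solve-∀
    ring₃ : ∀ m → m + (2 + m) ≡ suc (suc m) + m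
    ring₃ = solve-∀

rangeSum-decode : ∀ m φ → rangeSum (φ ∘ decode m) (nodeCount m) ≡ nodeSum m φ
rangeSum-decode m φ = begin
    rangeSum (φ ∘ decode m) (3 + (m + (2 + m)))
  ≡⟨ rangeSum-cons (φ ∘ decode m) (2 + (m + (2 + m))) ⟩
    φ root + rangeSum (λ i → φ (decode m (1 + i))) (2 + (m + (2 + m)))
  ≡⟨ cong (φ root +_) (rangeSum-cons (λ i → φ (decode m (1 + i))) (1 + (m + (2 + m)))) ⟩
    φ root + (φ linkA + rangeSum (λ i → φ (decode m (2 + i))) (1 + (m + (2 + m))))
  ≡⟨ cong (λ u → φ root + (φ linkA + u)) (rangeSum-cons (λ i → φ (decode m (2 + i))) (m + (2 + m))) ⟩
    φ root + (φ linkA + (φ centreA + rangeSum (λ i → φ (decode m (3 + i))) (m + (2 + m))))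
  ≡⟨ cong (λ u → φ root + (φ linkA + (φ centreA + u))) (rangeSum-+ᵣ (λ i → φ (decode m (3 + i))) m (2 + m)) ⟩
    φ root + (φ linkA + (φ centreA + (rangeSum (λ i → φ (decode m (3 + i))) m + sideB)))
  ≡⟨ cong₂ (λ u v → φ root + (φ linkA + (φ centreA + (u + v))))
           (rangeSum-cong m (λ i i<m → cong φ (decode-leafA m i i<m))) sideB≡ ⟩
    φ root + (φ linkA + (φ centreA + (rangeSum (φ ∘ leafA) m + (φ linkB + (φ centreB + rangeSum (φ ∘ leafB) m)))))
  ≡⟨ ring (φ root) (φ linkA) (φ centreA) (rangeSum (φ ∘ leafA) m) (φ linkB) (φ centreB) (rangeSum (φ ∘ leafB) m) ⟩
    nodeSum m φ ∎
  where
  open ≡-Reasoning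
  sideB = rangeSum (λ i → φ (decode m (3 + (m + i)))) (2 + m)
  sideB≡ : sideB ≡ φ linkB + (φ centreB + rangeSum (φ ∘ leafB) m)
  sideB≡ = trans (rangeSum-cons (λ i → φ (decode m (3 + (m + i)))) (1 + m)) (cong₂ _+_ (cong φ (decode-B m 0))
             (trans (rangeSum-cons (λ i → φ (decode m (3 + (m + suc i)))) m)
                    (cong₂ _+_ (cong φ (decode-B m 1)) (rangeSum-cong m (λ i _ → cong φ (decode-B m (2 + i)))))))
  ring : ∀ a b c d e f g → a + (b + (c + (d + (e + (f + g))))) ≡ a + b + c + d + e + f + g
  ring = solve-∀

decode-linkB : ∀ m → decode m (suc (suc (suc m))) ≡ linkB
decode-linkB m = trans (cong (λ u → decode m (3 + u)) (sym (+-identityʳ m))) (decode-B m 0)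

decode-centreB : ∀ m → decode m (suc (suc (suc (suc m)))) ≡ centreB
decode-centreB m = trans (cong (λ u → decode m (3 + u)) (+-comm 1 m)) (decode-B m 1)

centreA-edge : ∀ m b → 2 < b → b < 3 + m → TreeEdge m centreA (decode m b)
centreA-edge m (suc (suc (suc i))) _ b< =
  subst (TreeEdge m centreA) (sym (decode-leafA m i i<m)) (centreA-leafA i i<m)
  where
  i<m = ≤-pred (≤-pred (≤-pred b<))
centreA-edge m (suc (suc zero)) (s≤s (s≤s ())) _
centreA-edge m (suc zero) (s≤s ()) _

centreB-edge : ∀ m b → 4 + m < b → b < (3 + m) + (2 + m) → TreeEdge m centreB (decode m b)
centreB-edge m b <b b< = subst (TreeEdge m centreB) (sym decode-b) (centreB-leafB j j<m)
  where
  j = b ∸ (5 + m)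
  b≡ : b ≡ 3 + (m + (2 + j))
  b≡ = trans (sym (m∸n+n≡m {b} {5 + m} <b)) (ring₁ j m)
    where
    ring₁ : ∀ j m → j + (5 + m) ≡ 3 + (m + (2 + j))
    ring₁ = solve-∀
  decode-b : decode m b ≡ leafB j
  decode-b = trans (cong (decode m) b≡) (decode-B m (2 + j))
  j<m : j < m
  j<m = +-cancelˡ-< (5 + m) j m (begin
      suc (5 + m + j)          ≡⟨ cong suc (ring₂ j m) ⟩
      suc (3 + (m + (2 + j)))  ≡⟨ cong suc (sym b≡) ⟩
      suc b                    ≤⟨ b< ⟩
      3 + m + (2 + m)          ≡⟨ ring₃ m ⟩
      5 + m + m                ∎)
    where
    open ≤-Reasoning
    ring₂ : ∀ j m → 5 + m + j ≡ 3 + (m + (2 + j))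
    ring₂ = solve-∀
    ring₃ : ∀ m → 3 + m + (2 + m) ≡ 5 + m + m
    ring₃ = solve-∀

rootEdge⇒TreeEdge : ∀ m a b → T ((a ≡ᵇ 0) ∧ ((b ≡ᵇ 1) ∨ (b ≡ᵇ 3 + m))) → TreeEdge m (decode m a) (decode m b)
rootEdge⇒TreeEdge m a b t with T-∧-elim {a ≡ᵇ 0} {(b ≡ᵇ 1) ∨ (b ≡ᵇ 3 + m)} t
... | a≡ , b≡ with ≡ᵇ⇒≡ a 0 a≡ | T-∨-elim {b ≡ᵇ 1} {b ≡ᵇ 3 + m} b≡
...   | refl | inj₁ b≡1 with ≡ᵇ⇒≡ b 1 b≡1
...     | refl = root-linkA
rootEdge⇒TreeEdge m a b t | a≡ , b≡ | refl | inj₂ b≡3+m with ≡ᵇ⇒≡ b (3 + m) b≡3+m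
...     | refl = subst (TreeEdge m root) (sym (decode-linkB m)) root-linkB

starEdgeA⇒TreeEdge : ∀ m a b → T (starEdge (2 + m) 1 a b) → TreeEdge m (decode m a) (decode m b)
starEdgeA⇒TreeEdge m a b t with T-∨-elim {(a ≡ᵇ 1) ∧ (b ≡ᵇ 2)} t
... | inj₁ link with T-∧-elim {a ≡ᵇ 1} {b ≡ᵇ 2} link
...   | a≡ , b≡ with ≡ᵇ⇒≡ a 1 a≡ | ≡ᵇ⇒≡ b 2 b≡
...     | refl | refl = linkA-centreA
starEdgeA⇒TreeEdge m a b t | inj₂ star with T-∧-elim {a ≡ᵇ 2} {(2 <ᵇ b) ∧ (b <ᵇ 3 + m)} star
...   | a≡ , bounds with ≡ᵇ⇒≡ a 2 a≡ | T-∧-elim {2 <ᵇ b} {b <ᵇ 3 + m} bounds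
...     | refl | 2<b , b< = centreA-edge m b (<ᵇ⇒< 2 b 2<b) (<ᵇ⇒< b (3 + m) b<)

starEdgeB⇒TreeEdge : ∀ m a b → T (starEdge (2 + m) (3 + m) a b) → TreeEdge m (decode m a) (decode m b)
starEdgeB⇒TreeEdge m a b t with T-∨-elim {(a ≡ᵇ 3 + m) ∧ (b ≡ᵇ 4 + m)} t
... | inj₁ link with T-∧-elim {a ≡ᵇ 3 + m} {b ≡ᵇ 4 + m} link
...   | a≡ , b≡ with ≡ᵇ⇒≡ a (3 + m) a≡ | ≡ᵇ⇒≡ b (4 + m) b≡
...     | refl | refl = subst₂ (TreeEdge m) (sym (decode-linkB m)) (sym (decode-centreB m)) linkB-centreB
starEdgeB⇒TreeEdge m a b t | inj₂ star with T-∧-elim {a ≡ᵇ 4 + m} {(4 + m <ᵇ b) ∧ (b <ᵇ 3 + m + (2 + m))} star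
...   | a≡ , bounds with ≡ᵇ⇒≡ a (4 + m) a≡ | T-∧-elim {4 + m <ᵇ b} {b <ᵇ 3 + m + (2 + m)} bounds
...     | refl | <b , b< = subst (λ z → TreeEdge m z (decode m b)) (sym (decode-centreB m))
                             (centreB-edge m b (<ᵇ⇒< (4 + m) b <b) (<ᵇ⇒< b _ b<))

bananaEdge⇒TreeEdge : ∀ m a b → T (bananaEdge (suc (suc m)) a b) → TreeEdge m (decode m a) (decode m b)
bananaEdge⇒TreeEdge m a b t with T-∨-elim {(a ≡ᵇ 0) ∧ ((b ≡ᵇ 1) ∨ (b ≡ᵇ 3 + m))} t
... | inj₁ r = rootEdge⇒TreeEdge m a b r
... | inj₂ t′ with T-∨-elim {starEdge (2 + m) 1 a b} t′
...   | inj₁ sA = starEdgeA⇒TreeEdge m a b sA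
...   | inj₂ sB = starEdgeB⇒TreeEdge m a b sB

TreeEdge⇒bananaEdge : ∀ m p c → TreeEdge m p c → T (bananaEdge (suc (suc m)) (encode m p) (encode m c))
TreeEdge⇒bananaEdge m .root .linkA root-linkA = tt
TreeEdge⇒bananaEdge m .linkA .centreA linkA-centreA = tt
TreeEdge⇒bananaEdge m .centreA .(leafA i) (centreA-leafA i i<m) = T-∨ˡ (<⇒<ᵇ i<m)
TreeEdge⇒bananaEdge m .root .linkB root-linkB = T-∨ˡ (≡⇒≡ᵇ m m refl)
TreeEdge⇒bananaEdge m .linkB .centreB linkB-centreB =
  T-∨ʳ {x = false} (T-∨ʳ {x = false} (T-∨ˡ (T-∧-intro (≡⇒≡ᵇ m m refl) (≡⇒≡ᵇ m m refl))))
TreeEdge⇒bananaEdge m .centreB .(leafB i) (centreB-leafB i i<m) =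
  T-∨ʳ {x = false} (T-∨ʳ {x = false} (T-∨ʳ {x = (suc m ≡ᵇ m) ∧ _}
    (T-∧-intro (≡⇒≡ᵇ m m refl) (T-∧-intro (<⇒<ᵇ {4 + m} {5 + m + i} (s≤s (s≤s (s≤s (s≤s (s≤s (m≤m+n m i)))))))
                                          (<⇒<ᵇ {5 + m + i} {3 + m + (2 + m)} leaf<)))))
  where
  leaf< : 5 + m + i < 3 + m + (2 + m)
  leaf< = ≤-trans (≤-reflexive (ring₁ m i)) (≤-trans (+-monoʳ-≤ (5 + m) i<m) (≤-reflexive (ring₂ m)))
    where
    ring₁ : ∀ m i → suc (5 + m + i) ≡ 5 + m + suc i
    ring₁ = solve-∀
    ring₂ : ∀ m → 5 + m + m ≡ 3 + m + (2 + m)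
    ring₂ = solve-∀

-- The path length counts the tree edges (parent of x, x) separating u from v.
treeDist : ℕ → Node → Node → ℕ
treeDist m u v = nodeSum m (λ x → separates x u v)

separates≤1 : ∀ x u v → separates x u v ≤ 1
separates≤1 x u v with inSubtree x u xor inSubtree x v
... | true = ≤-refl
... | false = z≤n

treeDist-self : ∀ m u → treeDist m u u ≡ 0
treeDist-self m u = trans (nodeSum-cong m (λ x → cong ⟦_⟧ (xor-same (inSubtree x u)))) (nodeSum-0 m)

treeDist≤nodeCount : ∀ m u v → treeDist m u v ≤ nodeCount m
treeDist≤nodeCount m u v = ≤-trans (nodeSum-mono m (λ x _ → separates≤1 x u v)) (≤-reflexive (nodeSum-1 m))

TreeEdge-valid : ∀ {m p c} → TreeEdge m p c → Valid m c
TreeEdge-valid root-linkA = tt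
TreeEdge-valid linkA-centreA = tt
TreeEdge-valid (centreA-leafA i x) = x
TreeEdge-valid root-linkB = tt
TreeEdge-valid linkB-centreB = tt
TreeEdge-valid (centreB-leafB i x) = x

treeDist-+δ : ∀ {m p c} → TreeEdge m p c → ∀ φ → nodeSum m (λ x → φ x + ⟦ sameNode x c ⟧) ≡ nodeSum m φ + 1
treeDist-+δ {m} {c = c} t φ =
  trans (nodeSum-+ m φ (λ x → ⟦ sameNode x c ⟧)) (cong (nodeSum m φ +_) (nodeSum-δ m c (TreeEdge-valid t)))

treeDist-child≤ : ∀ {m p c} → TreeEdge m p c → ∀ u → treeDist m u c ≤ treeDist m u p + 1
treeDist-child≤ {m} {p} t u =
  ≤-trans (nodeSum-mono m (λ x _ → separates-child≤ t x u)) (≤-reflexive (treeDist-+δ t (λ x → separates x u p)))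

treeDist-parent≤ : ∀ {m p c} → TreeEdge m p c → ∀ u → treeDist m u p ≤ treeDist m u c + 1
treeDist-parent≤ {m} {c = c} t u =
  ≤-trans (nodeSum-mono m (λ x _ → separates-parent≤ t x u)) (≤-reflexive (treeDist-+δ t (λ x → separates x u c)))

treeDist-child≡ : ∀ {m p c} → TreeEdge m p c → ∀ u → inSubtree c u ≡ false → treeDist m u c ≡ suc (treeDist m u p)
treeDist-child≡ {m} {p} t u ∉ =
  trans (nodeSum-cong m (separates-child≡ t u ∉)) (trans (treeDist-+δ t (λ x → separates x u p)) (+-comm _ 1))

treeDist-parent≡ : ∀ {m p c} → TreeEdge m p c → ∀ u → inSubtree c u ≡ true → treeDist m u p ≡ suc (treeDist m u c)
treeDist-parent≡ {m} {c = c} t u ∈ =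
  trans (nodeSum-cong m (separates-parent≡ t u ∈)) (trans (treeDist-+δ t (λ x → separates x u c)) (+-comm _ 1))

Step : ℕ → Node → Node → Set
Step m u v = Σ Node (λ w → Valid m w × (TreeEdge m w v ⊎ TreeEdge m v w) × treeDist m u v ≡ suc (treeDist m u w))

step-up : ∀ {m p c} → TreeEdge m p c → Valid m p → ∀ u → inSubtree c u ≡ false → Step m u c
step-up {p = p} t vp u f = p , vp , inj₁ t , treeDist-child≡ t u f

step-down : ∀ {m p c} → TreeEdge m p c → ∀ u → inSubtree c u ≡ true → Step m u p
step-down {c = c} t u f = c , TreeEdge-valid t , inj₂ t , treeDist-parent≡ t u f

step : ∀ m u v → Valid m u → Valid m v → ¬ (u ≡ v) → Step m u v
step m root root vu vv ne = ⊥-elim (ne refl)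
step m linkA root vu vv ne = step-down root-linkA linkA refl
step m centreA root vu vv ne = step-down root-linkA centreA refl
step m (leafA i) root vu vv ne = step-down root-linkA (leafA i) refl
step m linkB root vu vv ne = step-down root-linkB linkB refl
step m centreB root vu vv ne = step-down root-linkB centreB refl
step m (leafB i) root vu vv ne = step-down root-linkB (leafB i) refl
step m linkA linkA vu vv ne = ⊥-elim (ne refl)
step m centreA linkA vu vv ne = step-down linkA-centreA centreA refl
step m (leafA i) linkA vu vv ne = step-down linkA-centreA (leafA i) refl
step m root linkA vu vv ne = step-up root-linkA tt root refl
step m linkB linkA vu vv ne = step-up root-linkA tt linkB refl
step m centreB linkA vu vv ne = step-up root-linkA tt centreB refl
step m (leafB i) linkA vu vv ne = step-up root-linkA tt (leafB i) refl
step m centreA centreA vu vv ne = ⊥-elim (ne refl)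
step m (leafA i) centreA vu vv ne = step-down (centreA-leafA i vu) (leafA i) (≡ᵇ-refl i)
step m root centreA vu vv ne = step-up linkA-centreA tt root refl
step m linkA centreA vu vv ne = step-up linkA-centreA tt linkA refl
step m linkB centreA vu vv ne = step-up linkA-centreA tt linkB refl
step m centreB centreA vu vv ne = step-up linkA-centreA tt centreB refl
step m (leafB i) centreA vu vv ne = step-up linkA-centreA tt (leafB i) refl
step m u (leafA j) vu vv ne with inSubtree (leafA j) u in eq
... | false = step-up (centreA-leafA j vv) tt u eq
step m (leafA i) (leafA j) vu vv ne | true = ⊥-elim (ne (cong leafA (sym (≡ᵇ⇒≡ j i (subst T (sym eq) tt)))))
step m linkB linkB vu vv ne = ⊥-elim (ne refl)
step m centreB linkB vu vv ne = step-down linkB-centreB centreB refl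
step m (leafB i) linkB vu vv ne = step-down linkB-centreB (leafB i) refl
step m root linkB vu vv ne = step-up root-linkB tt root refl
step m linkA linkB vu vv ne = step-up root-linkB tt linkA refl
step m centreA linkB vu vv ne = step-up root-linkB tt centreA refl
step m (leafA i) linkB vu vv ne = step-up root-linkB tt (leafA i) refl
step m centreB centreB vu vv ne = ⊥-elim (ne refl)
step m (leafB i) centreB vu vv ne = step-down (centreB-leafB i vu) (leafB i) (≡ᵇ-refl i)
step m root centreB vu vv ne = step-up linkB-centreB tt root refl
step m linkA centreB vu vv ne = step-up linkB-centreB tt linkA refl
step m centreA centreB vu vv ne = step-up linkB-centreB tt centreA refl
step m (leafA i) centreB vu vv ne = step-up linkB-centreB tt (leafA i) refl
step m linkB centreB vu vv ne = step-up linkB-centreB tt linkB refl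
step m u (leafB j) vu vv ne with inSubtree (leafB j) u in eq
... | false = step-up (centreB-leafB j vv) tt u eq
step m (leafB i) (leafB j) vu vv ne | true = ⊥-elim (ne (cong leafB (sym (≡ᵇ⇒≡ j i (subst T (sym eq) tt)))))

T-any-elim : ∀ {A : Set} (p : A → Bool) xs → T (any p xs) → Σ A (λ w → T (p w))
T-any-elim p (x ∷ xs) t with T-∨-elim {p x} t
... | inj₁ px = x , px
... | inj₂ t′ = T-any-elim p xs t′

T-any-intro : ∀ {A : Set} (p : A → Bool) xs w → w ∈ xs → T (p w) → T (any p xs)
T-any-intro p (x ∷ xs) .x (here refl) t = T-∨ˡ t
T-any-intro p (x ∷ xs) w (there w∈) t = T-∨ʳ {p x} (T-any-intro p xs w w∈ t)

module DistanceCharacterisation {N : ℕ} (adj : Fin N → Fin N → Bool) (d : Fin N → Fin N → ℕ)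
  (d-self : ∀ u → d u u ≡ 0) (d≤N : ∀ u v → d u v ≤ N)
  (d-edge : ∀ u w v → T (adj w v) → d u v ≤ d u w + 1)
  (d-step : ∀ u v → ¬ u ≡ v → Σ (Fin N) (λ w → T (adj w v) × d u v ≡ suc (d u w))) where

  reach-zero : ∀ u v → T (reach adj 0 u v) → u ≡ v
  reach-zero u v t with u ≟ᶠ v
  ... | yes u≡v = u≡v

  reach-self : ∀ t u → t ≡ 0 → T (reach adj t u u)
  reach-self .0 u refl with u ≟ᶠ u
  ... | yes _ = tt
  ... | no u≢u = u≢u refl

  searchDist-spec : ∀ u v cur fuel → T (reach adj (searchDist adj u v cur fuel) u v) ⊎ searchDist adj u v cur fuel ≡ cur + fuel
  searchDist-spec u v cur zero = inj₂ (sym (+-identityʳ cur))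
  searchDist-spec u v cur (suc fuel) with reach adj cur u v in e
  ... | true = inj₁ (subst T (sym e) tt)
  ... | false with searchDist-spec u v (suc cur) fuel
  ...   | inj₁ t = inj₁ t
  ...   | inj₂ q = inj₂ (trans q (sym (+-suc cur fuel)))

  searchDist-minimal : ∀ u v cur fuel t → cur ≤ t → t ≤ cur + fuel → T (reach adj t u v) → searchDist adj u v cur fuel ≤ t
  searchDist-minimal u v cur zero t cur≤t _ _ = cur≤t
  searchDist-minimal u v cur (suc fuel) t cur≤t t≤ r with reach adj cur u v in e
  ... | true = cur≤t
  ... | false = searchDist-minimal u v (suc cur) fuel t cur<t (subst (t ≤_) (+-suc cur fuel) t≤) r
    where
    cur<t : suc cur ≤ t
    cur<t with m≤n⇒m<n∨m≡n cur≤t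
    ... | inj₁ lt = lt
    ... | inj₂ refl = ⊥-elim (subst T e r)

  reach⇒d≤ : ∀ t u v → T (reach adj t u v) → d u v ≤ t
  reach⇒d≤ zero u v r with reach-zero u v r
  ... | refl = ≤-reflexive (d-self u)
  reach⇒d≤ (suc t) u v r with T-∨-elim {reach adj t u v} r
  ... | inj₁ r′ = ≤-trans (reach⇒d≤ t u v r′) (n≤1+n t)
  ... | inj₂ r′ with T-any-elim (λ w → reach adj t u w ∧ adj w v) (allFin N) r′
  ...   | w , rw with T-∧-elim {reach adj t u w} rw
  ...     | r″ , e = ≤-trans (d-edge u w v e) (≤-trans (+-monoˡ-≤ 1 (reach⇒d≤ t u w r″)) (≤-reflexive (+-comm t 1)))

  d≡t⇒reach : ∀ t u v → d u v ≡ t → T (reach adj t u v)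
  d≡t⇒reach t u v e with u ≟ᶠ v
  d≡t⇒reach t u .u e | yes refl = reach-self t u (trans (sym e) (d-self u))
  d≡t⇒reach zero u v e | no u≢v with d-step u v u≢v
  ... | w , _ , q = ⊥-elim (1+n≢0 (trans (sym q) e))
  d≡t⇒reach (suc t) u v e | no u≢v with d-step u v u≢v
  ... | w , a , q = T-∨ʳ {reach adj t u v} (T-any-intro (λ w → reach adj t u w ∧ adj w v) (allFin N) w (∈-allFin w)
                      (T-∧-intro (d≡t⇒reach t u w (suc-injective (trans (sym q) e))) a))

  dist≡d : ∀ u v → dist adj u v ≡ d u v
  dist≡d u v = ≤-antisym
    (searchDist-minimal u v 0 N (d u v) z≤n (d≤N u v) (d≡t⇒reach (d u v) u v refl))
    (lower (searchDist-spec u v 0 N))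
    where
    lower : T (reach adj (dist adj u v) u v) ⊎ dist adj u v ≡ N → d u v ≤ dist adj u v
    lower (inj₁ r) = reach⇒d≤ _ u v r
    lower (inj₂ q) = ≤-trans (d≤N u v) (≤-reflexive (sym q))

module BananaDistance (N m : ℕ) (N≡ : N ≡ nodeCount m) where

  node : Fin N → Node
  node a = decode m (toℕ a)

  private
    toℕ<nodeCount : ∀ (a : Fin N) → toℕ a < nodeCount m
    toℕ<nodeCount a = subst (toℕ a <_) N≡ (toℕ<n a)

    encode-node : ∀ a → encode m (node a) ≡ toℕ a
    encode-node a = proj₁ (encode-decode m (toℕ a) (toℕ<nodeCount a))

    node-valid : ∀ a → Valid m (node a)
    node-valid a = proj₂ (encode-decode m (toℕ a) (toℕ<nodeCount a))

    vertex : ∀ x → Valid m x → Fin N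
    vertex x v = fromℕ< (subst (encode m x <_) (sym N≡) (encode< m x v))

    toℕ-vertex : ∀ x v → toℕ (vertex x v) ≡ encode m x
    toℕ-vertex x v = toℕ-fromℕ< (subst (encode m x <_) (sym N≡) (encode< m x v))

    node-vertex : ∀ x v → node (vertex x v) ≡ x
    node-vertex x v = trans (cong (decode m) (toℕ-vertex x v)) (decode-encode m x v)

    adj = bananaAdj N (suc (suc m))
    d : Fin N → Fin N → ℕ
    d a b = treeDist m (node a) (node b)

    d-edge : ∀ u w v → T (adj w v) → d u v ≤ d u w + 1
    d-edge u w v t with T-∨-elim {bananaEdge (suc (suc m)) (toℕ w) (toℕ v)} t
    ... | inj₁ e = treeDist-child≤ (bananaEdge⇒TreeEdge m (toℕ w) (toℕ v) e) (node u)
    ... | inj₂ e = treeDist-parent≤ (bananaEdge⇒TreeEdge m (toℕ v) (toℕ w) e) (node u)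

    d-step : ∀ u v → ¬ u ≡ v → Σ (Fin N) (λ w → T (adj w v) × d u v ≡ suc (d u w))
    d-step u v u≢v
      with step m (node u) (node v) (node-valid u) (node-valid v)
             (λ e → u≢v (toℕ-injective (trans (sym (encode-node u)) (trans (cong (encode m) e) (encode-node v)))))
    ... | w , w-valid , inj₁ w→v , closer = vertex w w-valid ,
      T-∨ˡ (subst T (cong₂ (bananaEdge (suc (suc m))) (sym (toℕ-vertex w w-valid)) (encode-node v))
                    (TreeEdge⇒bananaEdge m w (node v) w→v)) ,
      trans closer (cong (λ z → suc (treeDist m (node u) z)) (sym (node-vertex w w-valid)))
    ... | w , w-valid , inj₂ v→w , closer = vertex w w-valid ,
      T-∨ʳ {bananaEdge (suc (suc m)) (toℕ (vertex w w-valid)) (toℕ v)}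
        (subst T (cong₂ (bananaEdge (suc (suc m))) (encode-node v) (sym (toℕ-vertex w w-valid)))
                 (TreeEdge⇒bananaEdge m (node v) w v→w)) ,
      trans closer (cong (λ z → suc (treeDist m (node u) z)) (sym (node-vertex w w-valid)))

  dist≡treeDist : ∀ a b → dist (bananaAdj N (suc (suc m))) a b ≡ treeDist m (node a) (node b)
  dist≡treeDist = DistanceCharacterisation.dist≡d adj d
    (λ u → treeDist-self m (node u))
    (λ u v → subst (d u v ≤_) (sym N≡) (treeDist≤nodeCount m (node u) (node v)))
    d-edge d-step

-- The lexicographic embedding

-- The optimal embedding lists the vertices in lexicographic order along the node encoding
-- after rotating its first m + 3 positions: ranks 0, …, m go to centreA and the leaves of A,
-- rank m + 1 to linkA and rank m + 2 to the root; the B side keeps its encoding.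
shift : ℕ → ℕ → ℕ
shift m r = if r <ᵇ suc m then 2 + r else (if r ≡ᵇ suc m then 1 else (if r ≡ᵇ suc (suc m) then 0 else r))

data ShiftView (m : ℕ) : ℕ → Set where
  inStarA : ∀ i → i < suc m → ShiftView m i
  isLinkA : ShiftView m (suc m)
  isRoot : ShiftView m (suc (suc m))
  inSideB : ∀ j → ShiftView m (3 + (m + j))

shiftView : ∀ m r → ShiftView m r
shiftView m r with <-cmp r (suc m)
... | tri< lt _ _ = inStarA r lt
... | tri≈ _ refl _ = isLinkA
... | tri> _ _ gt with <-cmp r (suc (suc m))
...   | tri< lt _ _ = ⊥-elim (<-irrefl refl (≤-trans lt gt))
...   | tri≈ _ refl _ = isRoot
...   | tri> _ _ gt2 = subst (ShiftView m) (ring r m gt2) (inSideB (r ∸ (3 + m)))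
  where
  ring : ∀ r m → suc (suc m) < r → 3 + (m + (r ∸ (3 + m))) ≡ r
  ring r m p = trans (sym (+-assoc 3 m (r ∸ (3 + m)))) (m+[n∸m]≡n {3 + m} {r} p)

<ᵇ-true : ∀ {a b} → a < b → (a <ᵇ b) ≡ true
<ᵇ-true p = T⇒≡true (<⇒<ᵇ p)

<ᵇ-false : ∀ {a b} → b ≤ a → (a <ᵇ b) ≡ false
<ᵇ-false {a} {b} p = ¬T⇒≡false (λ t → <-irrefl refl (≤-trans (<ᵇ⇒< a b t) p))

≡ᵇ-false : ∀ {a b} → a < b → (b ≡ᵇ a) ≡ false
≡ᵇ-false {a} {b} p = ¬T⇒≡false (λ t → <-irrefl (sym (≡ᵇ⇒≡ b a t)) p)

shift-starA : ∀ m i → i < suc m → shift m i ≡ 2 + i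
shift-starA m i p rewrite <ᵇ-true p = refl

shift-linkA : ∀ m → shift m (suc m) ≡ 1
shift-linkA m rewrite <ᵇ-false {suc m} {suc m} ≤-refl | ≡ᵇ-refl m = refl

shift-root : ∀ m → shift m (suc (suc m)) ≡ 0
shift-root m rewrite <ᵇ-false {suc (suc m)} {suc m} (n≤1+n _) | ≡ᵇ-false {m} {suc m} ≤-refl | ≡ᵇ-refl m = refl

shift-sideB : ∀ m j → shift m (3 + (m + j)) ≡ 3 + (m + j)
shift-sideB m j
  rewrite <ᵇ-false {3 + (m + j)} {suc m} (s≤s (≤-trans (m≤m+n m j) (≤-trans (n≤1+n _) (n≤1+n _))))
        | ≡ᵇ-false {m} {suc (suc (m + j))} (s≤s (≤-trans (m≤m+n m j) (n≤1+n _)))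
        | ≡ᵇ-false {suc m} {suc (suc (m + j))} (s≤s (s≤s (m≤m+n m j))) = refl

unshift : ℕ → ℕ → ℕ
unshift m zero = suc (suc m)
unshift m (suc zero) = suc m
unshift m (suc (suc a)) = if a <ᵇ suc m then a else suc (suc a)

shift-unshift : ∀ m a → shift m (unshift m a) ≡ a
shift-unshift m zero = shift-root m
shift-unshift m (suc zero) = shift-linkA m
shift-unshift m (suc (suc a)) with a <ᵇ suc m in e
... | true = shift-starA m a (<ᵇ⇒< a (suc m) (subst T (sym e) tt))
... | false with shiftView m (suc (suc a))
...   | inStarA i p = ⊥-elim (subst T e (<⇒<ᵇ (≤-trans (n≤1+n _) (≤-trans (n≤1+n _) p))))
...   | isLinkA = ⊥-elim (subst T e (<⇒<ᵇ {a} (n≤1+n (suc a))))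
...   | isRoot = ⊥-elim (subst T e (<⇒<ᵇ {a} ≤-refl))
...   | inSideB j = shift-sideB m j

unshift-shift : ∀ m r → unshift m (shift m r) ≡ r
unshift-shift m r with shiftView m r
... | inStarA i i< rewrite shift-starA m i i< | <ᵇ-true i< = refl
... | isLinkA rewrite shift-linkA m = refl
... | isRoot rewrite shift-root m = refl
... | inSideB j rewrite shift-sideB m j | <ᵇ-false {suc (m + j)} {suc m} (s≤s (m≤m+n m j)) = refl

shift-injective : ∀ m r r′ → shift m r ≡ shift m r′ → r ≡ r′
shift-injective m r r′ e = trans (sym (unshift-shift m r)) (trans (cong (unshift m) e) (unshift-shift m r′))

shift< : ∀ m r → r < nodeCount m → shift m r < nodeCount m
shift< m r p with shiftView m r
... | inStarA i q = ≤-trans (≤-reflexive (cong suc (shift-starA m i q))) (s≤s (s≤s (s≤s (≤-trans (≤-pred q) (m≤m+n m _)))))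
... | isLinkA = ≤-trans (≤-reflexive (cong suc (shift-linkA m))) (s≤s (s≤s z≤n))
... | isRoot = ≤-trans (≤-reflexive (cong suc (shift-root m))) (s≤s z≤n)
... | inSideB j = ≤-trans (≤-reflexive (cong suc (shift-sideB m j))) p

unshift< : ∀ m a → a < nodeCount m → unshift m a < nodeCount m
unshift< m zero p = s≤s (s≤s (s≤s (m≤m+n m _)))
unshift< m (suc zero) p = s≤s (s≤s (≤-trans (m≤m+n m _) (n≤1+n _)))
unshift< m (suc (suc a)) p with a <ᵇ suc m
... | true = ≤-trans (n≤1+n _) (≤-trans (n≤1+n _) p)
... | false = p

node-shift-leafA : ∀ m i → suc i < suc m → decode m (shift m (suc i)) ≡ leafA i
node-shift-leafA m i p = trans (cong (decode m) (shift-starA m (suc i) p)) (decode-leafA m i (≤-pred p))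

node-shift-linkA : ∀ m → decode m (shift m (suc m)) ≡ linkA
node-shift-linkA m = cong (decode m) (shift-linkA m)

node-shift-root : ∀ m → decode m (shift m (suc (suc m))) ≡ root
node-shift-root m = cong (decode m) (shift-root m)

node-shift-sideB : ∀ m j → decode m (shift m (3 + (m + j))) ≡ decodeB j
node-shift-sideB m j = trans (cong (decode m) (shift-sideB m j)) (decode-B m j)

sideB≥ : ∀ m j → 3 + m ≤ 3 + (m + j)
sideB≥ m j = +-monoʳ-≤ 3 (m≤m+n m j)

linkA∌decodeB : ∀ j → inSubtree linkA (decodeB j) ≡ false
linkA∌decodeB zero = refl
linkA∌decodeB (suc zero) = refl
linkA∌decodeB (suc (suc j)) = refl

centreA∌decodeB : ∀ j → inSubtree centreA (decodeB j) ≡ false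
centreA∌decodeB zero = refl
centreA∌decodeB (suc zero) = refl
centreA∌decodeB (suc (suc j)) = refl

linkB∋decodeB : ∀ j → inSubtree linkB (decodeB j) ≡ true
linkB∋decodeB zero = refl
linkB∋decodeB (suc zero) = refl
linkB∋decodeB (suc (suc j)) = refl

centreB∋decodeB-suc : ∀ j → inSubtree centreB (decodeB (suc j)) ≡ true
centreB∋decodeB-suc zero = refl
centreB∋decodeB-suc (suc j) = refl

inSubtree-linkA-shift : ∀ m r → inSubtree linkA (decode m (shift m r)) ≡ (r <ᵇ suc (suc m))
inSubtree-linkA-shift m r with shiftView m r
... | inStarA zero p = refl
... | inStarA (suc i) p rewrite node-shift-leafA m i p = sym (<ᵇ-true (≤-trans p (n≤1+n _)))
... | isLinkA rewrite node-shift-linkA m = sym (<ᵇ-true {suc m} ≤-refl)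
... | isRoot rewrite node-shift-root m = sym (<ᵇ-false {suc (suc m)} ≤-refl)
... | inSideB j rewrite node-shift-sideB m j | linkA∌decodeB j =
  sym (<ᵇ-false (≤-trans (n≤1+n _) (sideB≥ m j)))

inSubtree-centreA-shift : ∀ m r → inSubtree centreA (decode m (shift m r)) ≡ (r <ᵇ suc m)
inSubtree-centreA-shift m r with shiftView m r
... | inStarA zero p = refl
... | inStarA (suc i) p rewrite node-shift-leafA m i p = sym (<ᵇ-true p)
... | isLinkA rewrite node-shift-linkA m = sym (<ᵇ-false {suc m} ≤-refl)
... | isRoot rewrite node-shift-root m = sym (<ᵇ-false {suc (suc m)} {suc m} (n≤1+n _))
... | inSideB j rewrite node-shift-sideB m j | centreA∌decodeB j =
  sym (<ᵇ-false (≤-trans (≤-trans (n≤1+n _) (n≤1+n _)) (sideB≥ m j)))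

inSubtree-linkB-shift : ∀ m r → inSubtree linkB (decode m (shift m r)) ≡ not (r <ᵇ 3 + m)
inSubtree-linkB-shift m r with shiftView m r
... | inStarA zero p = refl
... | inStarA (suc i) p rewrite node-shift-leafA m i p | <ᵇ-true {suc i} {3 + m} (≤-trans p (≤-trans (n≤1+n _) (n≤1+n _))) = refl
... | isLinkA rewrite node-shift-linkA m | <ᵇ-true {suc m} {3 + m} (n≤1+n _) = refl
... | isRoot rewrite node-shift-root m | <ᵇ-true {suc (suc m)} {3 + m} ≤-refl = refl
... | inSideB j rewrite node-shift-sideB m j | linkB∋decodeB j | <ᵇ-false (sideB≥ m j) = refl

inSubtree-centreB-shift : ∀ m r → inSubtree centreB (decode m (shift m r)) ≡ not (r <ᵇ 4 + m)
inSubtree-centreB-shift m r with shiftView m r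
... | inStarA zero p = refl
... | inStarA (suc i) p
  rewrite node-shift-leafA m i p | <ᵇ-true {suc i} {4 + m} (≤-trans p (≤-trans (n≤1+n _) (≤-trans (n≤1+n _) (n≤1+n _)))) = refl
... | isLinkA rewrite node-shift-linkA m | <ᵇ-true {suc m} {4 + m} (≤-trans (n≤1+n _) (n≤1+n _)) = refl
... | isRoot rewrite node-shift-root m | <ᵇ-true {suc (suc m)} {4 + m} (n≤1+n _) = refl
... | inSideB zero rewrite node-shift-sideB m 0 | <ᵇ-true {3 + (m + 0)} {4 + m} (+-monoʳ-≤ 4 (≤-reflexive (+-identityʳ m))) = refl
... | inSideB (suc j)
  rewrite node-shift-sideB m (suc j) | centreB∋decodeB-suc j
        | <ᵇ-false {3 + (m + suc j)} {4 + m} (+-monoʳ-≤ 3 (≤-trans (s≤s (m≤m+n m j)) (≤-reflexive (sym (+-suc m j))))) = refl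

sumMap-allFin-suc : ∀ N (φ : Fin (suc N) → ℕ) → sumMap φ (allFin (suc N)) ≡ φ 0F + sumMap (φ ∘ fsuc) (allFin N)
sumMap-allFin-suc N φ = cong (φ 0F +_) (trans (cong sum (map-tabulate fsuc φ)) (sym (cong sum (map-tabulate id (φ ∘ fsuc)))))

isYes-fsuc≟fsuc : ∀ {N} (a b : Fin N) → isYes (fsuc a ≟ᶠ fsuc b) ≡ isYes (a ≟ᶠ b)
isYes-fsuc≟fsuc a b with a ≟ᶠ b
... | yes refl = refl
... | no _ = refl

sumMap-allFin-δ : ∀ N (a : Fin N) (g : Fin N → ℕ) → sumMap (λ y → if isYes (a ≟ᶠ y) then g y else 0) (allFin N) ≡ g a
sumMap-allFin-δ (suc N) 0F g =
  trans (sumMap-allFin-suc N (λ y → if isYes (0F ≟ᶠ y) then g y else 0))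
        (trans (cong (g 0F +_) (sumMap-0 (allFin N))) (+-identityʳ _))
sumMap-allFin-δ (suc N) (fsuc a) g =
  trans (sumMap-allFin-suc N (λ y → if isYes (fsuc a ≟ᶠ y) then g y else 0))
    (trans (sumMap-cong (λ y → cong (λ b → if b then g (fsuc y) else 0) (isYes-fsuc≟fsuc a y)) (allFin N))
           (sumMap-allFin-δ N a (g ∘ fsuc)))

sumMap-allFin≡rangeSum : ∀ N (φ : ℕ → ℕ) → sumMap (λ y → φ (toℕ y)) (allFin N) ≡ rangeSum φ N
sumMap-allFin≡rangeSum zero φ = refl
sumMap-allFin≡rangeSum (suc N) φ =
  trans (sumMap-allFin-suc N (φ ∘ toℕ)) (trans (cong (φ 0 +_) (sumMap-allFin≡rangeSum N (φ ∘ suc))) (sym (rangeSum-cons φ N)))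

vertexSum-bijection : ∀ n {N} (f : Vertex n ⤖ Fin N) (g : Fin N → ℕ) →
                      vertexSum n (λ v → g (Bijection.to f v)) ≡ sumMap g (allFin N)
vertexSum-bijection n {N} f g =
  begin
    vertexSum n (λ v → g (to v))
  ≡⟨ sumMap-cong (λ v → sym (sumMap-allFin-δ N (to v) g)) (allVecs n) ⟩
    sumMap (λ v → sumMap (λ y → if isYes (to v ≟ᶠ y) then g y else 0) (allFin N)) (allVecs n)
  ≡⟨ sumMap-swap (λ v y → if isYes (to v ≟ᶠ y) then g y else 0) (allVecs n) (allFin N) ⟩
    sumMap (λ y → sumMap (λ v → if isYes (to v ≟ᶠ y) then g y else 0) (allVecs n)) (allFin N)
  ≡⟨ sumMap-cong (λ y → trans (sumMap-cong (λ v → cong (λ b → if b then g y else 0) (pt v y)) (allVecs n))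
                              (vertexSum-δ n (x y) (λ _ → g y))) (allFin N) ⟩
    sumMap g (allFin N) ∎
  where
  open ≡-Reasoning
  open Bijection f using (to; injective; surjective)
  x : Fin N → Vertex n
  x y = proj₁ (surjective y)
  to-x : ∀ y → to (x y) ≡ y
  to-x y = proj₂ (surjective y) refl
  pt : ∀ v y → isYes (to v ≟ᶠ y) ≡ sameVec (x y) v
  pt v y = T-extensional
    (λ t → subst T (sym (sameVec-refl′ (injective (trans (to-x y) (sym (toWitness t)))))) tt)
    (λ t → fromWitness (trans (cong to (sym (sameVec-sound (x y) v (T⇒≡true t)))) (to-x y)))
    where
    sameVec-refl′ : ∀ {u w : Vertex n} → u ≡ w → sameVec u w ≡ true
    sameVec-refl′ {u} refl = sameVec-refl u

-- The least possible cut of an s-vertex set of K₃ⁿ, a 2n-regular graph.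
edgeBoundary : ℕ → ℕ → ℕ
edgeBoundary n s = (n + n) * s ∸ 2 * maxEdges s

edgeBoundary≤cut : ∀ n P → edgeBoundary n (size n P) ≤ cut n P
edgeBoundary≤cut n P = m≤n+o⇒m∸n≤o ((n + n) * size n P) (2 * maxEdges (size n P)) (begin
    (n + n) * size n P                       ≡⟨ sym (cut+2*inner n P) ⟩
    cut n P + 2 * inner n P                  ≤⟨ +-monoʳ-≤ (cut n P) (*-monoʳ-≤ 2 (inner≤maxEdges n P)) ⟩
    cut n P + 2 * maxEdges (size n P)        ≡⟨ +-comm (cut n P) _ ⟩
    2 * maxEdges (size n P) + cut n P        ∎)
  where open ≤-Reasoning

cut≤degree*size : ∀ n P → cut n P ≤ (n + n) * size n P
cut≤degree*size n P = ≤-trans (m≤m+n (cut n P) (2 * inner n P)) (≤-reflexive (cut+2*inner n P))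

edgeBoundary-exact : ∀ n s c → (n + n) * s ≡ 2 * maxEdges s + c → edgeBoundary n s ≡ c
edgeBoundary-exact n s c e = trans (cong (_∸ 2 * maxEdges s) e) (m+n∸m≡n (2 * maxEdges s) c)

cut-lex≡edgeBoundary : ∀ n s → s ≤ 3 ^ n → cut n (lexBelow s) ≡ edgeBoundary n s
cut-lex≡edgeBoundary n s s≤ =
  sym (edgeBoundary-exact n s _ (trans (sym (cut-lex n s s≤)) (+-comm (cut n (lexBelow s)) _)))

module Dimension (n' : ℕ) where

  n = suc (suc n')
  k = halfPow3 (suc n')
  -- Each star has K = ⌊3ⁿ/2⌋ = m + 2 vertices; m is written so that m + 1 = 3k is a ring identity.
  m = thrice (halfPow3 n') + (thrice (halfPow3 n') + 1) + (thrice (halfPow3 n') + 1)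
  K = suc (suc m)

  1+m≡thrice-k : suc m ≡ thrice k
  1+m≡thrice-k = ring (thrice (halfPow3 n'))
    where
    ring : ∀ X → suc (X + (X + 1) + (X + 1)) ≡ X + 1 + (X + 1) + (X + 1)
    ring = solve-∀

  halfPow3≡K : halfPow3 n ≡ K
  halfPow3≡K = trans (+-comm (thrice k) 1) (cong suc (sym 1+m≡thrice-k))

  3^n≡nodeCount : 3 ^ n ≡ nodeCount m
  3^n≡nodeCount = trans (3^≡1+2*halfPow3 n) (trans (cong (λ u → suc (u + u)) halfPow3≡K) (ring m))
    where
    ring : ∀ m → suc (suc (suc m) + suc (suc m)) ≡ 3 + (m + (2 + m))
    ring = solve-∀

  open BananaDistance (3 ^ n) m 3^n≡nodeCount public using (node)

  dist≡treeDist : ∀ a b → dist (bananaQ n) a b ≡ treeDist m (node a) (node b)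
  dist≡treeDist a b = subst (λ k → dist (bananaAdj (3 ^ n) k) a b ≡ treeDist m (node a) (node b))
    (sym (trans (⌊3^/2⌋≡halfPow3 n) halfPow3≡K)) (BananaDistance.dist≡treeDist (3 ^ n) m 3^n≡nodeCount a b)

  Embedding = Vec (Fin 3) n ⤖ Fin (3 ^ n)

  inverseImage : Embedding → Node → Vertex n → Bool
  inverseImage f x v = inSubtree x (node (Bijection.to f v))

  -- Each tree edge (parent of x, x) is crossed by exactly the edges cut by the inverse image of the subtree at x.
  WLf≡Σcut : ∀ f → WLf n f ≡ nodeSum m (λ x → cut n (inverseImage f x))
  WLf≡Σcut f = begin
      WLf n f
    ≡⟨ edgeSum-cong n (λ e → dist≡treeDist (to (proj₁ e)) (to (proj₂ e))) ⟩
      edgeSum n (λ e → treeDist m (node (to (proj₁ e))) (node (to (proj₂ e))))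
    ≡⟨ nodeSum-swap m (λ e x → separates x (node (to (proj₁ e))) (node (to (proj₂ e)))) (edgesQ n) ⟩
      nodeSum m (λ x → cut n (inverseImage f x)) ∎
    where
    open ≡-Reasoning
    open Bijection f using (to)

  subtreeSize : Node → ℕ
  subtreeSize x = nodeSum m (λ y → ⟦ inSubtree x y ⟧)

  size-inverseImage : ∀ f x → size n (inverseImage f x) ≡ subtreeSize x
  size-inverseImage f x = begin
      size n (inverseImage f x)
    ≡⟨ vertexSum-bijection n f (λ a → ⟦ inSubtree x (node a) ⟧) ⟩
      sumMap (λ a → ⟦ inSubtree x (decode m (toℕ a)) ⟧) (allFin (3 ^ n))
    ≡⟨ sumMap-allFin≡rangeSum (3 ^ n) (λ a → ⟦ inSubtree x (decode m a) ⟧) ⟩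
      rangeSum (λ a → ⟦ inSubtree x (decode m a) ⟧) (3 ^ n)
    ≡⟨ cong (rangeSum (λ a → ⟦ inSubtree x (decode m a) ⟧)) 3^n≡nodeCount ⟩
      rangeSum (λ a → ⟦ inSubtree x (decode m a) ⟧) (nodeCount m)
    ≡⟨ rangeSum-decode m (λ y → ⟦ inSubtree x y ⟧) ⟩
      subtreeSize x ∎
    where open ≡-Reasoning

  optimum : ℕ
  optimum = nodeSum m (λ x → edgeBoundary n (subtreeSize x))

  optimum≤WLf : ∀ f → optimum ≤ WLf n f
  optimum≤WLf f = begin
      optimum
    ≤⟨ nodeSum-mono m (λ x _ → subst (λ s → edgeBoundary n s ≤ cut n (inverseImage f x))
                                     (size-inverseImage f x) (edgeBoundary≤cut n (inverseImage f x))) ⟩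
      nodeSum m (λ x → cut n (inverseImage f x))
    ≡⟨ sym (WLf≡Σcut f) ⟩
      WLf n f ∎
    where open ≤-Reasoning

  subtreeSize-linkA : subtreeSize linkA ≡ K
  subtreeSize-linkA rewrite rangeSum-const 1 m | rangeSum-const 0 m | *-identityʳ m | *-zeroʳ m = ring m
    where
    ring : ∀ m → 0 + 1 + 1 + m + 0 + 0 + 0 ≡ suc (suc m)
    ring = solve-∀

  subtreeSize-centreA : subtreeSize centreA ≡ suc m
  subtreeSize-centreA rewrite rangeSum-const 1 m | rangeSum-const 0 m | *-identityʳ m | *-zeroʳ m = ring m
    where
    ring : ∀ m → 0 + 0 + 1 + m + 0 + 0 + 0 ≡ suc m
    ring = solve-∀

  subtreeSize-linkB : subtreeSize linkB ≡ K
  subtreeSize-linkB rewrite rangeSum-const 1 m | rangeSum-const 0 m | *-identityʳ m | *-zeroʳ m = ring m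
    where
    ring : ∀ m → 0 + 0 + 0 + 0 + 1 + 1 + m ≡ suc (suc m)
    ring = solve-∀

  subtreeSize-centreB : subtreeSize centreB ≡ suc m
  subtreeSize-centreB rewrite rangeSum-const 1 m | rangeSum-const 0 m | *-identityʳ m | *-zeroʳ m = ring m
    where
    ring : ∀ m → 0 + 0 + 0 + 0 + 0 + 1 + m ≡ suc m
    ring = solve-∀

  subtreeSize-leafA : ∀ i → i < m → subtreeSize (leafA i) ≡ 1
  subtreeSize-leafA i i<m rewrite rangeSum-const 0 m | *-zeroʳ m =
    trans (trans (+-identityʳ _) (trans (+-identityʳ _) (+-identityʳ _)))
          (trans (rangeSum-cong m (λ j _ → cong ⟦_⟧ (≡ᵇ-sym i j))) (rangeSum-δ m i i<m))

  subtreeSize-leafB : ∀ i → i < m → subtreeSize (leafB i) ≡ 1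
  subtreeSize-leafB i i<m rewrite rangeSum-const 0 m | *-zeroʳ m =
    trans (rangeSum-cong m (λ j _ → cong ⟦_⟧ (≡ᵇ-sym i j))) (rangeSum-δ m i i<m)

  edgeBoundary-K : edgeBoundary n K ≡ K + K
  edgeBoundary-K = edgeBoundary-exact n K (K + K)
    (subst (λ z → (n + n) * z ≡ 2 * maxEdges z + (z + z)) halfPow3≡K (boundary-halfPow3 n))

  edgeBoundary-1+K : edgeBoundary n (suc K) ≡ K + K
  edgeBoundary-1+K = edgeBoundary-exact n (suc K) (K + K)
    (subst (λ z → (n + n) * suc z ≡ 2 * maxEdges (suc z) + (z + z)) halfPow3≡K (boundary-1+halfPow3 n))

  edgeBoundary-1+m : edgeBoundary n (suc m) ≡ suc m + suc m
  edgeBoundary-1+m = edgeBoundary-exact n (suc m) (suc m + suc m)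
    (subst (λ z → (n + n) * z ≡ 2 * maxEdges z + (z + z)) (sym 1+m≡thrice-k) (boundary-halfPow3-1 (suc n')))

  edgeBoundary-2+K : edgeBoundary n (suc (suc K)) ≡ suc m + suc m
  edgeBoundary-2+K = edgeBoundary-exact n (suc (suc K)) (suc m + suc m)
    (subst₂ (λ z t → (n + n) * suc (suc z) ≡ 2 * maxEdges (suc (suc z)) + (t + t)) halfPow3≡K (sym 1+m≡thrice-k)
            (boundary-2+halfPow3 (suc n')))

  private
    shift<3^n : ∀ r → r < 3 ^ n → shift m r < 3 ^ n
    shift<3^n r r< = subst (shift m r <_) (sym 3^n≡nodeCount) (shift< m r (subst (r <_) 3^n≡nodeCount r<))

    ≤2+K⇒≤3^n : ∀ j → j ≤ suc (suc K) → j ≤ 3 ^ n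
    ≤2+K⇒≤3^n j j≤ = ≤-trans j≤ (≤-trans (+-monoʳ-≤ 3 (≤-trans (≤-reflexive (+-comm 1 m)) (+-monoʳ-≤ m (s≤s z≤n))))
                                          (≤-reflexive (sym 3^n≡nodeCount)))

  -- A leaf's inverse image is a single vertex, whose cut is its degree 2n.
  cut≤edgeBoundary-leaf : ∀ f x → subtreeSize x ≡ 1 → cut n (inverseImage f x) ≤ edgeBoundary n (subtreeSize x)
  cut≤edgeBoundary-leaf f x size≡1 = begin
      cut n (inverseImage f x)                       ≤⟨ cut≤degree*size n (inverseImage f x) ⟩
      (n + n) * size n (inverseImage f x)            ≡⟨ cong ((n + n) *_) (trans (size-inverseImage f x) size≡1) ⟩
      (n + n) * 1                                    ≡⟨ cong (λ s → (n + n) * s ∸ 2 * maxEdges s) (sym size≡1) ⟩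
      edgeBoundary n (subtreeSize x)                 ∎
    where open ≤-Reasoning

  toLex : Vertex n → Fin (3 ^ n)
  toLex v = fromℕ< (shift<3^n (rank v) (rank< v))

  toℕ-toLex : ∀ v → toℕ (toLex v) ≡ shift m (rank v)
  toℕ-toLex v = toℕ-fromℕ< _

  lexEmbedding : Embedding
  lexEmbedding = mk⤖ {to = toLex} (injective , surjective)
    where
    injective : ∀ {v w} → toLex v ≡ toLex w → v ≡ w
    injective {v} {w} e = rank-injective v w
      (shift-injective m (rank v) (rank w) (trans (sym (toℕ-toLex v)) (trans (cong toℕ e) (toℕ-toLex w))))
    surjective : ∀ a → Σ (Vertex n) (λ v → ∀ {w} → w ≡ v → toLex w ≡ a)
    surjective a = v , λ { refl → toℕ-injective (trans (toℕ-toLex v)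
                                   (trans (cong (shift m) (rank-unrank n r r<)) (shift-unshift m (toℕ a)))) }
      where
      r = unshift m (toℕ a)
      r< : r < 3 ^ n
      r< = subst (r <_) (sym 3^n≡nodeCount) (unshift< m (toℕ a) (subst (toℕ a <_) 3^n≡nodeCount (toℕ<n a)))
      v = unrank n r

  cut-lexEmbedding : ∀ x (P : ℕ → Bool) → (∀ r → inSubtree x (decode m (shift m r)) ≡ P r) →
                     cut n (inverseImage lexEmbedding x) ≡ cut n (P ∘ rank)
  cut-lexEmbedding x P inSubtree≡ = edgeSum-cong n λ e → cong₂ (λ p q → ⟦ p xor q ⟧) (on (proj₁ e)) (on (proj₂ e))
    where
    on : ∀ v → inverseImage lexEmbedding x v ≡ P (rank v)
    on v = trans (cong (λ a → inSubtree x (decode m a)) (toℕ-toLex v)) (inSubtree≡ (rank v))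

  cut-lexEmbedding≤ : ∀ x → Valid m x → cut n (inverseImage lexEmbedding x) ≤ edgeBoundary n (subtreeSize x)
  cut-lexEmbedding≤ root _ = ≤-trans (≤-reflexive (sumMap-0 (edgesQ n))) z≤n
  cut-lexEmbedding≤ linkA _ = ≤-reflexive (begin
      cut n (inverseImage lexEmbedding linkA)    ≡⟨ cut-lexEmbedding linkA _ (inSubtree-linkA-shift m) ⟩
      cut n (lexBelow K)                          ≡⟨ cut-lex≡edgeBoundary n K (≤2+K⇒≤3^n K (m≤n+m K 2)) ⟩
      edgeBoundary n K                            ≡⟨ cong (edgeBoundary n) (sym subtreeSize-linkA) ⟩
      edgeBoundary n (subtreeSize linkA)          ∎)
    where open ≡-Reasoning
  cut-lexEmbedding≤ centreA _ = ≤-reflexive (begin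
      cut n (inverseImage lexEmbedding centreA)  ≡⟨ cut-lexEmbedding centreA _ (inSubtree-centreA-shift m) ⟩
      cut n (lexBelow (suc m))                    ≡⟨ cut-lex≡edgeBoundary n (suc m) (≤2+K⇒≤3^n (suc m) (m≤n+m (suc m) 3)) ⟩
      edgeBoundary n (suc m)                      ≡⟨ cong (edgeBoundary n) (sym subtreeSize-centreA) ⟩
      edgeBoundary n (subtreeSize centreA)        ∎)
    where open ≡-Reasoning
  cut-lexEmbedding≤ linkB _ = ≤-reflexive (begin
      cut n (inverseImage lexEmbedding linkB)    ≡⟨ cut-lexEmbedding linkB _ (inSubtree-linkB-shift m) ⟩
      cut n (λ v → not (lexBelow (suc K) v))      ≡⟨ cut-complement n (lexBelow (suc K)) ⟩
      cut n (lexBelow (suc K))                    ≡⟨ cut-lex≡edgeBoundary n (suc K) (≤2+K⇒≤3^n (suc K) (n≤1+n _)) ⟩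
      edgeBoundary n (suc K)                      ≡⟨ trans edgeBoundary-1+K (sym edgeBoundary-K) ⟩
      edgeBoundary n K                            ≡⟨ cong (edgeBoundary n) (sym subtreeSize-linkB) ⟩
      edgeBoundary n (subtreeSize linkB)          ∎)
    where open ≡-Reasoning
  cut-lexEmbedding≤ centreB _ = ≤-reflexive (begin
      cut n (inverseImage lexEmbedding centreB)  ≡⟨ cut-lexEmbedding centreB _ (inSubtree-centreB-shift m) ⟩
      cut n (λ v → not (lexBelow (suc (suc K)) v)) ≡⟨ cut-complement n (lexBelow (suc (suc K))) ⟩
      cut n (lexBelow (suc (suc K)))              ≡⟨ cut-lex≡edgeBoundary n (suc (suc K)) (≤2+K⇒≤3^n _ ≤-refl) ⟩
      edgeBoundary n (suc (suc K))                ≡⟨ trans edgeBoundary-2+K (sym edgeBoundary-1+m) ⟩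
      edgeBoundary n (suc m)                      ≡⟨ cong (edgeBoundary n) (sym subtreeSize-centreB) ⟩
      edgeBoundary n (subtreeSize centreB)        ∎)
    where open ≡-Reasoning
  cut-lexEmbedding≤ (leafA i) i<m = cut≤edgeBoundary-leaf lexEmbedding (leafA i) (subtreeSize-leafA i i<m)
  cut-lexEmbedding≤ (leafB i) i<m = cut≤edgeBoundary-leaf lexEmbedding (leafB i) (subtreeSize-leafB i i<m)

  WLf-lex≤optimum : WLf n lexEmbedding ≤ optimum
  WLf-lex≤optimum = ≤-trans (≤-reflexive (WLf≡Σcut lexEmbedding)) (nodeSum-mono m cut-lexEmbedding≤)

  optimum≡WLvalue : optimum ≡ WLvalue n
  optimum≡WLvalue = begin
      cost root + cost linkA + cost centreA + rangeSum (cost ∘ leafA) m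
        + cost linkB + cost centreB + rangeSum (cost ∘ leafB) m
    ≡⟨ cong₂ _+_ (cong₂ _+_ (cong₂ _+_ (cong₂ _+_ (cong₂ _+_ (cong₂ _+_
         (trans (cong (edgeBoundary n) (nodeSum-0 m)) (*-zeroʳ (n + n)))
         (trans (cong (edgeBoundary n) subtreeSize-linkA) edgeBoundary-K))
         (trans (cong (edgeBoundary n) subtreeSize-centreA) edgeBoundary-1+m))
         (leaves leafA subtreeSize-leafA))
         (trans (cong (edgeBoundary n) subtreeSize-linkB) edgeBoundary-K))
         (trans (cong (edgeBoundary n) subtreeSize-centreB) edgeBoundary-1+m))
         (leaves leafB subtreeSize-leafB) ⟩
      0 + (K + K) + (suc m + suc m) + m * (n + n) + (K + K) + (suc m + suc m) + m * (n + n)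
    ≡⟨ ring n m ⟩
      4 * n * m + 4 * suc m + 4 * suc (suc m)
    ≡⟨ cong (λ c → 4 * n * (c ∸ 3) + 4 * (c ∸ 2) + 4 * (c ∸ 1))
            (sym (trans (⌈3^/2⌉≡1+halfPow3 n) (cong suc halfPow3≡K))) ⟩
      WLvalue n ∎
    where
    open ≡-Reasoning
    cost = λ x → edgeBoundary n (subtreeSize x)
    leaves : (leaf : ℕ → Node) → (∀ i → i < m → subtreeSize (leaf i) ≡ 1) → rangeSum (cost ∘ leaf) m ≡ m * (n + n)
    leaves leaf size≡1 = trans (rangeSum-cong m (λ i i<m → trans (cong (edgeBoundary n) (size≡1 i i<m)) (*-identityʳ (n + n))))
                               (rangeSum-const (n + n) m)
    ring : ∀ n m → 0 + (suc (suc m) + suc (suc m)) + (suc m + suc m) + m * (n + n) + (suc (suc m) + suc (suc m))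
                     + (suc m + suc m) + m * (n + n) ≡ 4 * n * m + 4 * suc m + 4 * suc (suc m)
    ring = solve-∀

theorem5p14 : (n : ℕ) → 2 ≤ n →
    Σ (Vec (Fin 3) n ⤖ Fin (3 ^ n)) (λ f → WLf n f ≡ WLvalue n)
    × ((f : Vec (Fin 3) n ⤖ Fin (3 ^ n)) → WLvalue n ≤ WLf n f)
theorem5p14 (suc (suc n')) _ =
  (lexEmbedding , ≤-antisym (≤-trans WLf-lex≤optimum (≤-reflexive optimum≡WLvalue)) (lower lexEmbedding)) , lower
  where
  open Dimension n'
  lower : ∀ f → WLvalue n ≤ WLf n f
  lower f = ≤-trans (≤-reflexive (sym optimum≡WLvalue)) (optimum≤WLf f)
theorem5p14 (suc zero) (s≤s ())
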